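{- Let $G$ be a twinless strongly connected digraph and let $v$ be a twinless strong articulation point of $G$ that is not a strong articulation point. Let $C$ be the $2$-vertex-connected component of the underlying undirected graph $G^u$ containing $v$, and let $\mathit{count}(v)$ be the number of edges $e$ of $C$ such that $C\setminus\{v,e\}$ is not connected. Then $\mathit{count}(v)+1$ is the number of twinless strongly connected components of $G\setminus v$.
   Context: Two edges $(x,y),(y,x)$ are twin edges. A digraph is twinless strongly connected if it has a strongly connected spanning subgraph without twin edges; twinless strongly connected components (TSCCs) are maximal twinless strongly connected subgraphs. A vertex is a twinless strong articulation point if its deletion increases the number of TSCCs, and a strong articulation point if its deletion increases the number of strongly connected components. $G^u$ is the undirected graph on $V(G)$ with an edge $\{u,w\}$ whenever $(u,w)$ or $(w,u)$ is an edge of $G$. A $2$-vertex-connected component is a maximal biconnected subgraph (block). -}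

module Defs where

open import Data.Nat using (ℕ; _<_)
open import Data.Fin using (Fin; toℕ)
open import Data.Fin.Subset using (Subset; _∈_; _∉_; _⊆_; ⊤; _-_; Nonempty)
open import Data.Bool using (Bool; true; false)
open import Data.Product using (Σ; ∃; ∃-syntax; _×_; _,_)
open import Data.List using (List; length)
open import Data.List.Relation.Unary.Unique.Propositional using (Unique)
import Data.List.Membership.Propositional as LM
open import Relation.Binary.PropositionalEquality using (_≡_)
open import Relation.Nullary using (¬_)
open import Function.Bundles using (_⇔_)

Digraph : ℕ → Set
Digraph n = Fin n → Fin n → Bool

Count : {A : Set} → (A → Set) → ℕ → Set
Count {A} P k = Σ (List A) λ xs →
  Unique xs × (∀ a → P a ⇔ (a LM.∈ xs)) × length xs ≡ k

module _ {n : ℕ} where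

  data Walk (S : Subset n) (R : Fin n → Fin n → Set) : Fin n → Fin n → Set where
    here : ∀ {x} → x ∈ S → Walk S R x x
    step : ∀ {x y z} → x ∈ S → R x y → Walk S R y z → Walk S R x z

  StronglyConnected : (R : Fin n → Fin n → Set) → Subset n → Set
  StronglyConnected R S = ∀ x y → x ∈ S → y ∈ S → Walk S R x y

  Edge : Digraph n → Fin n → Fin n → Set
  Edge E x y = E x y ≡ true

  TwinlessSC : Digraph n → Subset n → Set
  TwinlessSC E S = Σ (Digraph n) λ F →
      (∀ x y → Edge F x y → Edge E x y)
    × (∀ x y → ¬ (Edge F x y × Edge F y x))
    × StronglyConnected (Edge F) S

  MaximalIn : (Subset n → Set) → Subset n → Subset n → Set
  MaximalIn Q W S = S ⊆ W × Nonempty S × Q S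
    × (∀ T → S ⊆ T → T ⊆ W → Q T → T ⊆ S)

  -- Strongly connected components / twinless strongly connected components of
  -- the subgraph of G induced by the vertex set W (identified by vertex sets;
  -- a maximal (twinless) strongly connected subgraph is induced, since adding
  -- edges preserves the property).
  SCC : Digraph n → Subset n → Subset n → Set
  SCC E W = MaximalIn (StronglyConnected (Edge E)) W

  TSCC : Digraph n → Subset n → Subset n → Set
  TSCC E W = MaximalIn (TwinlessSC E) W

  NumSCC : Digraph n → Subset n → ℕ → Set
  NumSCC E W = Count (SCC E W)

  NumTSCC : Digraph n → Subset n → ℕ → Set
  NumTSCC E W = Count (TSCC E W)

  StrongArticulationPoint : Digraph n → Fin n → Set
  StrongArticulationPoint E v =
    Σ ℕ λ k → Σ ℕ λ k' → NumSCC E ⊤ k × NumSCC E (⊤ - v) k' × k < k'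

  TwinlessStrongArticulationPoint : Digraph n → Fin n → Set
  TwinlessStrongArticulationPoint E v =
    Σ ℕ λ k → Σ ℕ λ k' → NumTSCC E ⊤ k × NumTSCC E (⊤ - v) k' × k < k'

  UAdj : Digraph n → Fin n → Fin n → Set
  UAdj E x y = ¬ (x ≡ y) × (Edge E x y Data.Sum.⊎ Edge E y x)
    where import Data.Sum

  -- Undirected edges represented canonically as (a , b) with a < b.
  UEdge : Digraph n → Fin n × Fin n → Set
  UEdge E (a , b) = toℕ a < toℕ b × UAdj E a b

  Connected : (Fin n → Fin n → Set) → Subset n → Set
  Connected R S = ∀ x y → x ∈ S → y ∈ S → Walk S R x y

  Biconnected : Digraph n → Subset n → Set
  Biconnected E S =
      (Σ (Fin n) λ a → Σ (Fin n) λ b → a ∈ S × b ∈ S × ¬ (a ≡ b))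
    × Connected (UAdj E) S
    × (∀ x → x ∈ S → Connected (UAdj E) (S - x))

  -- 2-vertex-connected component (block) of G^u: a maximal biconnected
  -- subgraph (necessarily induced, hence identified by its vertex set).
  Block : Digraph n → Subset n → Set
  Block E S = Biconnected E S × (∀ T → S ⊆ T → Biconnected E T → T ⊆ S)

  WithoutEdge : Digraph n → Fin n × Fin n → Fin n → Fin n → Set
  WithoutEdge E (a , b) x y =
    UAdj E x y × ¬ ((x ≡ a × y ≡ b) Data.Sum.⊎ (x ≡ b × y ≡ a))
    where import Data.Sum

  CountEdge : Digraph n → Subset n → Fin n → Fin n × Fin n → Set
  CountEdge E S v (a , b) =
      UEdge E (a , b) × a ∈ S × b ∈ S
    × ¬ Connected (WithoutEdge E (a , b)) (S - v)

-- Lemma 6.  With W = V - v, the TSCCs of G - v are the components of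
-- G^u[W] minus its bridges, and those bridges are the counted edges of C:
--  * v is no strong articulation point, so G[W] is strongly connected;
--  * G^u is bridgeless (G is twinless) and the block C has no ears, hence an
--    edge of G^u[W] is a bridge iff it is counted (bypass-off-block,
--    counted-bridge, uncounted-bypass);
--  * twin removal: one edge of a twin pair on a non-bridge can be deleted
--    keeping strong connectivity, so G[W] has a strongly connected subgraph
--    whose twin pairs lie on bridges; thus every component is twinless
--    strongly connected, and no twinless strongly connected set crosses a
--    bridge;
--  * deleting k distinct bridges from a connected graph leaves k + 1
--    components.
module Submission where

open import Data.Nat as ℕ using (ℕ; suc; z≤n; s≤s)
import Data.Nat.Properties as ℕP
open import Data.Fin as F using (Fin; toℕ)
open import Data.Fin.Properties as FP using (_≟_; all?; any?; toℕ-injective)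
open import Data.Fin.Subset
  using (Subset; _∈_; _∉_; _⊆_; ⊤; _-_; _─_; ⁅_⁆; ∁; _∩_; ∣_∣; inside; outside)
open import Data.Fin.Subset.Properties
  using (_∈?_; x∈p∧x≢y⇒x∈p-y; x∈⁅x⁆; ⊆-antisym; ∈⊤; x∈p⇒∣p-x∣<∣p∣;
         x∈∁p⇒x∉p; x∉p⇒x∈∁p; x∈p∩q⁺; x∈p∩q⁻)
open import Data.Bool using (true; false; if_then_else_; _∧_)
import Data.Bool.Properties as BoolP
open import Data.Product using (Σ; ∃-syntax; _×_; _,_; proj₁; proj₂)
import Data.Product.Properties as ProductP
open import Data.Sum using (_⊎_; inj₁; inj₂; [_,_]′)
open import Data.List using (List; []; _∷_; length; filter; map; allFin; cartesianProduct)
import Data.List.Properties as ListP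
open import Data.List.Relation.Unary.All using (All; []; _∷_)
import Data.List.Relation.Unary.All as All
import Data.List.Relation.Unary.All.Properties as AllP
open import Data.List.Relation.Unary.Any using (here; there)
open import Data.List.Relation.Unary.Unique.Propositional using (Unique; []; _∷_)
import Data.List.Relation.Unary.Unique.Propositional.Properties as UniqueP
import Data.List.Membership.Propositional as LM
import Data.List.Membership.Propositional.Properties as LMP
import Data.List.Membership.DecPropositional as DecLM
import Data.Vec as Vec
open import Data.Vec.Properties using ([]=⇒lookup; lookup⇒[]=; lookup∘tabulate)
open import Relation.Binary using (tri<; tri≈; tri>)
open import Relation.Binary.PropositionalEquality
  using (_≡_; _≢_; refl; sym; trans; cong; subst; subst₂)
open import Relation.Nullary using (¬_; Dec; yes; no; does)
open import Relation.Nullary.Decidable using (_×-dec_; _⊎-dec_; _→-dec_; ¬?; decidable-stable; dec-true)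
open import Relation.Unary using (Decidable)
open import Data.Empty using (⊥; ⊥-elim)
open import Function.Base using (_∘_)
open import Function.Bundles using (mk⇔; Equivalence)
open import Defs

-- Finite sets and counting

x∈p─q⇒x∈p×x∉q : ∀ {n} {x : Fin n} (p q : Subset n) → x ∈ p ─ q → x ∈ p × x ∉ q
x∈p─q⇒x∈p×x∉q (inside Vec.∷ p) (outside Vec.∷ q) Vec.here = Vec.here , λ ()
x∈p─q⇒x∈p×x∉q (_ Vec.∷ p) (_ Vec.∷ q) (Vec.there m) with x∈p─q⇒x∈p×x∉q p q m
... | x∈p , x∉q = Vec.there x∈p , λ { (Vec.there x∈q) → x∉q x∈q }
x∈p─q⇒x∈p×x∉q {x = F.zero} (outside Vec.∷ p) (inside Vec.∷ q) ()
x∈p─q⇒x∈p×x∉q {x = F.zero} (outside Vec.∷ p) (outside Vec.∷ q) ()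

x∈p-y⇒x∈p×x≢y : ∀ {n} {x y : Fin n} (p : Subset n) → x ∈ p - y → x ∈ p × x ≢ y
x∈p-y⇒x∈p×x≢y {y = y} p m with x∈p─q⇒x∈p×x∉q p ⁅ y ⁆ m
... | x∈p , x∉⁅y⁆ = x∈p , λ { refl → x∉⁅y⁆ (x∈⁅x⁆ y) }

from-does : ∀ {P : Set} (d : Dec P) → does d ≡ true → P
from-does (yes p) _ = p
from-does (no _) ()

subsetOf : ∀ {n} {P : Fin n → Set} → Decidable P → Subset n
subsetOf P? = Vec.tabulate (λ x → does (P? x))

∈subsetOf⁺ : ∀ {n} {P : Fin n → Set} (P? : Decidable P) {x} → P x → x ∈ subsetOf P?
∈subsetOf⁺ P? {x} px = lookup⇒[]= x _ (trans (lookup∘tabulate _ x) (dec-true (P? x) px))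

∈subsetOf⁻ : ∀ {n} {P : Fin n → Set} (P? : Decidable P) {x} → x ∈ subsetOf P? → P x
∈subsetOf⁻ P? {x} m = from-does (P? x) (trans (sym (lookup∘tabulate _ x)) ([]=⇒lookup m))

subset-ext : ∀ {n} {p q : Subset n} → (∀ x → x ∈ p → x ∈ q) → (∀ x → x ∈ q → x ∈ p) → p ≡ q
subset-ext p⊆q q⊆p = ⊆-antisym (λ {x} → p⊆q x) (λ {x} → q⊆p x)

count-decidable : ∀ {n} {P : Fin n → Set} → Decidable P → ∃[ k ] Count P k
count-decidable {n} P? =
  _ , filter P? (allFin n) , UniqueP.filter⁺ P? (UniqueP.allFin⁺ n) ,
  (λ a → mk⇔ (λ pa → LMP.∈-filter⁺ P? (LMP.∈-allFin a) pa)
             (λ m → proj₂ (LMP.∈-filter⁻ P? {xs = allFin n} m))) ,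
  refl

count-unique : ∀ {A : Set} {P : A → Set} (r : A) → (∀ a → P a → a ≡ r) → P r → Count P 1
count-unique r only pr =
  r ∷ [] , ([] ∷ []) , (λ a → mk⇔ (λ pa → here (only a pa)) (λ { (here refl) → pr })) , refl

count-suc : ∀ {A : Set} {P P' : A → Set} {k} (r : A) → Count P k →
  (∀ a → P' a → P a ⊎ a ≡ r) → (∀ a → P a → P' a) → P' r → ¬ P r → Count P' (suc k)
count-suc {P = P} r (xs , uniq , mem , len) P'⊆ P⊆ p'r ¬pr =
  r ∷ xs ,
  (All.tabulate (λ {a} a∈ r≡a → ¬pr (Equivalence.from (mem r) (subst (LM._∈ xs) (sym r≡a) a∈))) ∷ uniq) ,
  (λ a → mk⇔ (λ p'a → into a (P'⊆ a p'a))
             (λ { (here refl) → p'r ; (there a∈) → P⊆ a (Equivalence.from (mem a) a∈) })) ,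
  cong suc len
  where
  into : ∀ a → P a ⊎ a ≡ r → a LM.∈ (r ∷ xs)
  into a (inj₁ pa) = there (Equivalence.to (mem a) pa)
  into a (inj₂ refl) = here refl

count-image : ∀ {A B : Set} {P : A → Set} {Q : B → Set} {k} (f : A → B) → Count P k →
  (∀ a b → P a → P b → f a ≡ f b → a ≡ b) →
  (∀ s → Q s → ∃[ a ] (P a × s ≡ f a)) → (∀ a → P a → Q (f a)) → Count Q k
count-image {P = P} {Q} f (xs , uniq , mem , len) inj onto into =
  map f xs , map-unique xs allP uniq ,
  (λ s → mk⇔
    (λ qs → let (a , pa , s≡fa) = onto s qs in
            subst (LM._∈ map f xs) (sym s≡fa) (LMP.∈-map⁺ f (Equivalence.to (mem a) pa)))
    (λ s∈ → let (a , a∈ , s≡fa) = LMP.∈-map⁻ f s∈ in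
            subst Q (sym s≡fa) (into a (Equivalence.from (mem a) a∈)))) ,
  trans (ListP.length-map f xs) len
  where
  allP : All P xs
  allP = All.tabulate (λ {a} a∈ → Equivalence.from (mem a) a∈)
  map-unique : ∀ ys → All P ys → Unique ys → Unique (map f ys)
  map-unique [] _ _ = []
  map-unique (y ∷ ys) (py ∷ pys) (y∉ ∷ u) =
    AllP.map⁺ (All.zipWith (λ { (pz , y≢z) fy≡fz → y≢z (inj y _ py pz fy≡fz) }) (pys , y∉))
    ∷ map-unique ys pys u

two≤count : ∀ {A : Set} {P : A → Set} {k} {a b : A} → Count P k → P a → P b → a ≢ b → 2 ℕ.≤ k
two≤count {P = P} {a = a} {b} (xs , _ , mem , refl) pa pb a≢b =
  go xs (Equivalence.to (mem a) pa) (Equivalence.to (mem b) pb)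
  where
  go : ∀ ys → a LM.∈ ys → b LM.∈ ys → 2 ℕ.≤ length ys
  go (_ ∷ []) (here refl) (here refl) = ⊥-elim (a≢b refl)
  go (_ ∷ []) _ (there ())
  go (_ ∷ []) (there ()) _
  go (_ ∷ _ ∷ _) _ _ = s≤s (s≤s z≤n)

least : ∀ {n} {P : Fin n → Set} → Decidable P → Σ (Fin n) P →
  Σ (Fin n) λ x → P x × (∀ y → P y → x F.≤ y)
least {suc n} {P} P? (x , px) with P? F.zero
... | yes p0 = F.zero , p0 , λ _ _ → z≤n
... | no ¬p0 with x
...   | F.zero = ⊥-elim (¬p0 px)
...   | F.suc x' with least {n} {λ y → P (F.suc y)} (λ y → P? (F.suc y)) (x' , px)
...     | m , pm , m≤ = F.suc m , pm , λ { F.zero p → ⊥-elim (¬p0 p) ; (F.suc y) p → s≤s (m≤ y p) }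

-- Walks

module _ {n : ℕ} where

  Rel : Set₁
  Rel = Fin n → Fin n → Set

  Dec₂ : Rel → Set
  Dec₂ R = ∀ x y → Dec (R x y)

  Symmetric : Rel → Set
  Symmetric R = ∀ a b → R a b → R b a

  module _ {S : Subset n} {R : Rel} where

    source : ∀ {x y} → Walk S R x y → x ∈ S
    source (here x∈) = x∈
    source (step x∈ _ _) = x∈

    target : ∀ {x y} → Walk S R x y → y ∈ S
    target (here y∈) = y∈
    target (step _ _ w) = target w

    infixr 5 _++ʷ_
    _++ʷ_ : ∀ {x y z} → Walk S R x y → Walk S R y z → Walk S R x z
    here _ ++ʷ w = w
    step x∈ r w ++ʷ w' = step x∈ r (w ++ʷ w')

    snocʷ : ∀ {x y z} → Walk S R x y → R y z → z ∈ S → Walk S R x z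
    snocʷ w r z∈ = w ++ʷ step (target w) r (here z∈)

    reverseʷ : Symmetric R → ∀ {x y} → Walk S R x y → Walk S R y x
    reverseʷ R-sym (here x∈) = here x∈
    reverseʷ R-sym (step x∈ r w) = snocʷ (reverseʷ R-sym w) (R-sym _ _ r) x∈

    toFirstArrival : ∀ {a b} → Walk S R a b → Walk S (λ p q → R p q × p ≢ b) a b
    toFirstArrival (here a∈) = here a∈
    toFirstArrival {b = b} (step {x = a} a∈ r w) with a ≟ b
    ... | yes refl = here a∈
    ... | no a≢b = step a∈ (r , a≢b) (toFirstArrival w)

    dropLoops : ∀ {x y} → Walk S R x y → Walk S (λ p q → R p q × p ≢ q) x y
    dropLoops (here x∈) = here x∈
    dropLoops (step {x = a} {y = b} x∈ r w) with a ≟ b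
    ... | yes refl = dropLoops w
    ... | no a≢b = step x∈ (r , a≢b) (dropLoops w)

  mapʷ : ∀ {S S' : Subset n} {R R' : Rel} → (∀ z → z ∈ S → z ∈ S') →
    (∀ a b → a ∈ S → b ∈ S → R a b → R' a b) → ∀ {x y} → Walk S R x y → Walk S' R' x y
  mapʷ f g (here x∈) = here (f _ x∈)
  mapʷ f g (step x∈ r w) = step (f _ x∈) (g _ _ x∈ (source w) r) (mapʷ f g w)

  substituteʷ : ∀ {S S' : Subset n} {R R' : Rel} →
    (∀ a b → a ∈ S → b ∈ S → R a b → Walk S' R' a b) →
    (∀ z → z ∈ S → z ∈ S') → ∀ {x y} → Walk S R x y → Walk S' R' x y
  substituteʷ f g (here x∈) = here (g _ x∈)
  substituteʷ f g (step x∈ r w) = f _ _ x∈ (source w) r ++ʷ substituteʷ f g w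

  connected-via-hub : ∀ {R : Rel} {X : Subset n} → Symmetric R → (h : Fin n) →
    (∀ z → z ∈ X → Walk X R z h) → Connected R X
  connected-via-hub R-sym h to-hub x y x∈ y∈ = to-hub x x∈ ++ʷ reverseʷ R-sym (to-hub y y∈)

  avoid-or-exit : ∀ {S : Subset n} {R : Rel} {x a y} → Walk S R a y → y ≢ x →
    Walk (S - x) R a y ⊎ ∃[ z ] (R x z × Walk (S - x) R z y)
  avoid-or-exit (here y∈) y≢x = inj₁ (here (x∈p∧x≢y⇒x∈p-y y∈ y≢x))
  avoid-or-exit {x = x} (step {x = a} {y = b} a∈ r w) y≢x with avoid-or-exit w y≢x
  ... | inj₂ exit = inj₂ exit
  ... | inj₁ w' with a ≟ x
  ...   | yes refl = inj₂ (b , r , w')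
  ...   | no a≢x = inj₁ (step (x∈p∧x≢y⇒x∈p-y a∈ a≢x) r w')

  lastExit : ∀ {S : Subset n} {R : Rel} {x y} → Walk S R x y → x ≢ y →
    ∃[ z ] (R x z × Walk (S - x) R z y)
  lastExit {S} w x≢y with avoid-or-exit w (λ y≡x → x≢y (sym y≡x))
  ... | inj₂ exit = exit
  ... | inj₁ w' = ⊥-elim (proj₂ (x∈p-y⇒x∈p×x≢y S (source w')) refl)

  -- Reachability along a decidable relation is decidable (by recursion on
  -- the size of the vertex set, using lastExit).
  walk? : ∀ {R : Rel} → Dec₂ R → (S : Subset n) → ∀ x y → Dec (Walk S R x y)
  walk? {R} R? S = bounded (suc ∣ S ∣) S ℕP.≤-refl
    where
    bounded : (k : ℕ) → (S : Subset n) → ∣ S ∣ ℕ.< k → ∀ x y → Dec (Walk S R x y)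
    bounded (suc k) S (s≤s ∣S∣≤k) x y with x ∈? S | y ∈? S | x ≟ y
    ... | no x∉ | _ | _ = no (λ w → x∉ (source w))
    ... | yes _ | no y∉ | _ = no (λ w → y∉ (target w))
    ... | yes x∈ | yes _ | yes refl = yes (here x∈)
    ... | yes x∈ | yes _ | no x≢y
      with any? (λ z → R? x z ×-dec bounded k (S - x) (ℕP.≤-trans (x∈p⇒∣p-x∣<∣p∣ x∈) ∣S∣≤k) z y)
    ...   | yes (z , r , w) = yes (step x∈ r (mapʷ (λ _ m → proj₁ (x∈p-y⇒x∈p×x≢y S m)) (λ _ _ _ _ r → r) w))
    ...   | no none = no (λ w → none (lastExit w x≢y))

  firstExit : ∀ {S : Subset n} {R : Rel} {A : Fin n → Set} → Decidable A → ∀ {x y} →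
    Walk S R x y → A x → ¬ A y → ∃[ p ] ∃[ q ] (A p × ¬ A q × R p q × p ∈ S × q ∈ S)
  firstExit A? (here _) ax ¬ay = ⊥-elim (¬ay ax)
  firstExit A? (step {y = b} p∈ r w) ax ¬ay with A? b
  ... | yes ab = firstExit A? w ab ¬ay
  ... | no ¬ab = _ , b , ax , ¬ab , r , p∈ , source w

  shortcut : ∀ {Y S : Subset n} {R : Rel} (s₀ : Fin n) → Decidable (_∈ S) →
    (∀ p q → p ∈ Y → q ∈ Y → R p q → (p ∈ S → q ∉ S → p ≡ s₀) × (p ∉ S → q ∈ S → q ≡ s₀)) →
    ∀ {a y} → Walk Y R a y → y ∈ S → (a ∈ S → Walk S R a y) × (a ∉ S → Walk S R s₀ y)
  shortcut s₀ S? cross (here y∈) y∈S = (λ _ → here y∈S) , (λ a∉S → ⊥-elim (a∉S y∈S))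
  shortcut {S = S} s₀ S? cross (step {y = b} a∈ r w) y∈S with shortcut s₀ S? cross w y∈S | S? b
  ... | from-b , _ | yes b∈S =
    (λ a∈S → step a∈S r (from-b b∈S)) ,
    (λ a∉S → subst (λ z → Walk S _ z _) (proj₂ (cross _ _ a∈ (source w) r) a∉S b∈S) (from-b b∈S))
  ... | _ , from-s₀ | no b∉S =
    (λ a∈S → subst (λ z → Walk S _ z _) (sym (proj₁ (cross _ _ a∈ (source w) r) a∈S b∉S)) (from-s₀ b∉S)) ,
    (λ _ → from-s₀ b∉S)

-- Paths with their vertex lists
--
-- A Path is a walk that is not confined to a vertex set; instead its list
-- of vertices is available, and the path is simple when that list is
-- Unique.  Simple paths are needed for the ear argument below, where a
-- vertex on a path must be avoidable by going to one of its two ends.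

module _ {n : ℕ} where

  data Path (R : Rel {n}) : Fin n → Fin n → Set where
    []ᵖ : ∀ {x} → Path R x x
    _∷ᵖ_ : ∀ {x y z} → R x y → Path R y z → Path R x z

  infixr 5 _∷ᵖ_

  _⊆ᴸ_ : List (Fin n) → List (Fin n) → Set
  xs ⊆ᴸ ys = ∀ {z} → z LM.∈ xs → z LM.∈ ys

  module _ {R : Rel {n}} where

    vertices : ∀ {x y} → Path R x y → List (Fin n)
    vertices {x} []ᵖ = x ∷ []
    vertices {x} (_ ∷ᵖ p) = x ∷ vertices p

    start∈ : ∀ {x y} (p : Path R x y) → x LM.∈ vertices p
    start∈ []ᵖ = here refl
    start∈ (_ ∷ᵖ _) = here refl

    toWalk : ∀ {S x y} (p : Path R x y) → All (_∈ S) (vertices p) → Walk S R x y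
    toWalk []ᵖ (x∈ ∷ []) = here x∈
    toWalk (r ∷ᵖ p) (x∈ ∷ ∈S) = step x∈ r (toWalk p ∈S)

    fromWalk : ∀ {S x y} → Walk S R x y → Σ (Path R x y) λ p → All (_∈ S) (vertices p)
    fromWalk (here x∈) = []ᵖ , x∈ ∷ []
    fromWalk (step x∈ r w) with fromWalk w
    ... | p , ∈S = r ∷ᵖ p , x∈ ∷ ∈S

    suffix : ∀ {x y z} (p : Path R x y) → z LM.∈ vertices p →
      Σ (Path R z y) λ s → (vertices s ⊆ᴸ vertices p) × (Unique (vertices p) → Unique (vertices s))
    suffix []ᵖ (here refl) = []ᵖ , (λ m → m) , (λ u → u)
    suffix (r ∷ᵖ p) (here refl) = r ∷ᵖ p , (λ m → m) , (λ u → u)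
    suffix (r ∷ᵖ p) (there z∈) with suffix p z∈
    ... | s , s⊆ , s-unique = s , (λ m → there (s⊆ m)) , (λ { (_ ∷ u) → s-unique u })

    prefix : ∀ {x y z} (p : Path R x y) → z LM.∈ vertices p →
      Σ (Path R x z) λ s → (vertices s ⊆ᴸ vertices p)
    prefix []ᵖ (here refl) = []ᵖ , (λ m → m)
    prefix (r ∷ᵖ p) (here refl) = []ᵖ , λ { (here refl) → here refl ; (there ()) }
    prefix (r ∷ᵖ p) (there z∈) with prefix p z∈
    ... | s , s⊆ = r ∷ᵖ s , λ { (here refl) → here refl ; (there m) → there (s⊆ m) }

    simplify : ∀ {x y} (p : Path R x y) →
      Σ (Path R x y) λ q → Unique (vertices q) × (vertices q ⊆ᴸ vertices p)
    simplify []ᵖ = []ᵖ , ([] ∷ []) , (λ m → m)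
    simplify {x} (r ∷ᵖ p) = extend (simplify p) (x ∈ᴸ? vertices (proj₁ (simplify p)))
      where
      open DecLM (_≟_ {n}) using () renaming (_∈?_ to _∈ᴸ?_)
      extend : (q : Σ (Path R _ _) λ q → Unique (vertices q) × (vertices q ⊆ᴸ vertices p)) →
        Dec (x LM.∈ vertices (proj₁ q)) →
        Σ (Path R x _) λ q' → Unique (vertices q') × (vertices q' ⊆ᴸ vertices (r ∷ᵖ p))
      extend (q , u , q⊆) (yes x∈q) =
        let (s , s⊆ , s-unique) = suffix q x∈q in s , s-unique u , (λ m → there (q⊆ (s⊆ m)))
      extend (q , u , q⊆) (no x∉q) =
        r ∷ᵖ q , (All.tabulate (λ {w} w∈ x≡w → x∉q (subst (LM._∈ vertices q) (sym x≡w) w∈)) ∷ u) ,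
        λ { (here refl) → here refl ; (there m) → there (q⊆ m) }

    avoid : ∀ {x y z w} (p : Path R x y) → Unique (vertices p) → z LM.∈ vertices p → w ≢ z →
      (Σ (Path R x z) λ s → ¬ (w LM.∈ vertices s) × (vertices s ⊆ᴸ vertices p)) ⊎
      (Σ (Path R z y) λ s → ¬ (w LM.∈ vertices s) × (vertices s ⊆ᴸ vertices p))
    avoid []ᵖ _ (here refl) w≢z = inj₁ ([]ᵖ , (λ { (here w≡z) → w≢z w≡z ; (there ()) }) , λ m → m)
    avoid (r ∷ᵖ p) _ (here refl) w≢z =
      inj₁ ([]ᵖ , (λ { (here w≡z) → w≢z w≡z ; (there ()) }) , λ { (here refl) → here refl ; (there ()) })
    avoid {x = x} {w = w} (r ∷ᵖ p) (x∉p ∷ u) (there z∈) w≢z with w ≟ x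
    ... | yes refl with suffix p z∈
    ...   | s , s⊆ , _ = inj₂ (s , (λ w∈ → All.lookup x∉p (s⊆ w∈) refl) , λ m → there (s⊆ m))
    avoid {x = x} {w = w} (r ∷ᵖ p) (x∉p ∷ u) (there z∈) w≢z | no w≢x with avoid p u z∈ w≢z
    ...   | inj₂ (s , w∉s , s⊆) = inj₂ (s , w∉s , λ m → there (s⊆ m))
    ...   | inj₁ (s , w∉s , s⊆) = inj₁ (r ∷ᵖ s , (λ { (here w≡x) → w≢x w≡x ; (there m) → w∉s m }) ,
                                        λ { (here refl) → here refl ; (there m) → there (s⊆ m) })

  reverseᵖ : ∀ {R : Rel {n}} → Symmetric R → ∀ {x y} (p : Path R x y) →
    Σ (Path R y x) λ q → (vertices q ⊆ᴸ vertices p)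
  reverseᵖ R-sym []ᵖ = []ᵖ , λ m → m
  reverseᵖ {R} R-sym {x} (r ∷ᵖ p) with reverseᵖ R-sym p
  ... | q , q⊆ = append q r , λ m → append⊆ q r q⊆ m
    where
    append : ∀ {a b} → Path R a b → R x b → Path R a x
    append []ᵖ r' = R-sym _ _ r' ∷ᵖ []ᵖ
    append (r' ∷ᵖ q') r'' = r' ∷ᵖ append q' r''
    append⊆ : ∀ {a b} (q' : Path R a b) (r' : R x b) →
      vertices q' ⊆ᴸ vertices p → vertices (append q' r') ⊆ᴸ vertices (r ∷ᵖ p)
    append⊆ []ᵖ r' q'⊆ (here refl) = there (q'⊆ (here refl))
    append⊆ []ᵖ r' q'⊆ (there (here refl)) = here refl
    append⊆ (r₁ ∷ᵖ q') r' q'⊆ (here refl) = there (q'⊆ (here refl))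
    append⊆ (r₁ ∷ᵖ q') r' q'⊆ (there m) = append⊆ q' r' (λ m' → q'⊆ (there m')) m

-- The underlying undirected graph

module _ {n : ℕ} (G : Digraph n) where

  edge? : Dec₂ (Edge G)
  edge? x y = G x y BoolP.≟ true

  uadj? : Dec₂ (UAdj G)
  uadj? x y = ¬? (x ≟ y) ×-dec (edge? x y ⊎-dec edge? y x)

  uadj-sym : Symmetric (UAdj G)
  uadj-sym a b (a≢b , inj₁ e) = (λ b≡a → a≢b (sym b≡a)) , inj₂ e
  uadj-sym a b (a≢b , inj₂ e) = (λ b≡a → a≢b (sym b≡a)) , inj₁ e

  undirected : ∀ {S x y} → Walk S (Edge G) x y → Walk S (UAdj G) x y
  undirected w = mapʷ (λ _ m → m) (λ _ _ _ _ (e , a≢b) → a≢b , inj₁ e) (dropLoops w)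

-- Ears of blocks
--
-- An ear of C is a path outside C joining two distinct vertices of C.
-- Attaching it to a biconnected C keeps it biconnected, so a block has no
-- ears; consequently walks between vertices of a block may be assumed to
-- stay inside it.

module EarAttachment {n : ℕ} (G : Digraph n) (C : Subset n) (bic : Biconnected G C)
  {a b s t : Fin n} (a∈C : a ∈ C) (b∈C : b ∈ C) (a≢b : a ≢ b)
  (a-s : UAdj G a s) (q : Path (UAdj G) s t) (simple : Unique (vertices q))
  (q∉C : ∀ {z} → z LM.∈ vertices q → z ∉ C) (t-b : UAdj G t b) where

  private
    U : Rel {n}
    U = UAdj G
    open DecLM (_≟_ {n}) using () renaming (_∈?_ to _∈ᴸ?_)
    C-connected : Connected U C
    C-connected = proj₁ (proj₂ bic)
    C-cut : ∀ x → x ∈ C → Connected U (C - x)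
    C-cut = proj₂ (proj₂ bic)

  T? : Decidable (λ z → z ∈ C ⊎ z LM.∈ vertices q)
  T? z = z ∈? C ⊎-dec z ∈ᴸ? vertices q

  T : Subset n
  T = subsetOf T?

  C⊆T : ∀ {z} → z ∈ C → z ∈ T
  C⊆T z∈ = ∈subsetOf⁺ T? (inj₁ z∈)

  q⊆T : ∀ {z} → z LM.∈ vertices q → z ∈ T
  q⊆T z∈ = ∈subsetOf⁺ T? (inj₂ z∈)

  to-a : ∀ {X z} → z LM.∈ vertices q → (∀ {w} → w LM.∈ vertices q → w ∈ X) → a ∈ X → Walk X U z a
  to-a z∈ q⊆X a∈X =
    let (pre , pre⊆) = prefix q z∈
        (back , back⊆) = reverseᵖ (uadj-sym G) pre
    in snocʷ (toWalk back (All.tabulate (λ m → q⊆X (pre⊆ (back⊆ m))))) (uadj-sym G _ _ a-s) a∈X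

  to-b : ∀ {X z} → z LM.∈ vertices q → (∀ {w} → w LM.∈ vertices q → w ∈ X) → b ∈ X → Walk X U z b
  to-b z∈ q⊆X b∈X =
    let (suf , suf⊆ , _) = suffix q z∈
    in snocʷ (toWalk suf (All.tabulate (λ m → q⊆X (suf⊆ m)))) t-b b∈X

  connected : Connected U T
  connected = connected-via-hub (uadj-sym G) a λ z z∈ →
    [ (λ z∈C → mapʷ (λ _ → C⊆T) (λ _ _ _ _ r → r) (C-connected z a z∈C a∈C))
    , (λ z∈q → to-a z∈q q⊆T (C⊆T a∈C)) ]′ (∈subsetOf⁻ T? z∈)

  -- Removing a vertex x of C: every vertex reaches an end e ≢ x of the ear,
  -- through C - x (connected) or along the ear (which avoids C).
  cut-in-C : ∀ x → x ∈ C → ∀ e → e ∈ C → e ≢ x →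
    (∀ {z} → z LM.∈ vertices q → Walk (T - x) U z e) → Connected U (T - x)
  cut-in-C x x∈C e e∈C e≢x along-q = connected-via-hub (uadj-sym G) e λ z z∈ →
    let (z∈T , z≢x) = x∈p-y⇒x∈p×x≢y T z∈ in
    [ (λ z∈C → mapʷ (λ _ m → let (m∈C , ≢x) = x∈p-y⇒x∈p×x≢y C m in x∈p∧x≢y⇒x∈p-y (C⊆T m∈C) ≢x)
                    (λ _ _ _ _ r → r)
                    (C-cut x x∈C z e (x∈p∧x≢y⇒x∈p-y z∈C z≢x) (x∈p∧x≢y⇒x∈p-y e∈C e≢x)))
    , along-q ]′ (∈subsetOf⁻ T? z∈T)

  -- Removing a vertex x of the ear: each ear vertex avoids x towards one of
  -- the ends (q is simple), and C is untouched.
  cut-on-ear : ∀ x → x ∉ C → Connected U (T - x)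
  cut-on-ear x x∉C = connected-via-hub (uadj-sym G) a λ z z∈ →
    let (z∈T , z≢x) = x∈p-y⇒x∈p×x≢y T z∈ in
    [ (λ z∈C → mapʷ (λ _ → C⊆T-x) (λ _ _ _ _ r → r) (C-connected z a z∈C a∈C))
    , (λ z∈q → [ (λ (pre , x∉pre , pre⊆) →
                   let (back , back⊆) = reverseᵖ (uadj-sym G) pre in
                   snocʷ (toWalk back (All.tabulate (λ m → ear⊆T-x pre x∉pre (pre⊆ (back⊆ m)) (back⊆ m))))
                         (uadj-sym G _ _ a-s) (C⊆T-x a∈C))
               , (λ (suf , x∉suf , suf⊆) →
                   snocʷ (toWalk suf (All.tabulate (λ m → ear⊆T-x suf x∉suf (suf⊆ m) m))) t-b (C⊆T-x b∈C)
                   ++ʷ mapʷ (λ _ → C⊆T-x) (λ _ _ _ _ r → r) (C-connected b a b∈C a∈C)) ]′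
               (avoid q simple z∈q (λ x≡z → z≢x (sym x≡z))))
    ]′ (∈subsetOf⁻ T? z∈T)
    where
    C⊆T-x : ∀ {w} → w ∈ C → w ∈ T - x
    C⊆T-x w∈C = x∈p∧x≢y⇒x∈p-y (C⊆T w∈C) (λ w≡x → x∉C (subst (_∈ C) w≡x w∈C))
    ear⊆T-x : ∀ {y z w} (p : Path U y z) → ¬ x LM.∈ vertices p →
      w LM.∈ vertices q → w LM.∈ vertices p → w ∈ T - x
    ear⊆T-x p x∉p w∈q w∈p = x∈p∧x≢y⇒x∈p-y (q⊆T w∈q) (λ w≡x → x∉p (subst (LM._∈ vertices p) w≡x w∈p))

  biconnected : Biconnected G T
  biconnected = (a , b , C⊆T a∈C , C⊆T b∈C , a≢b) , connected , cut
    where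
    avoids : ∀ {x} → x ∈ C → ∀ {w} → w LM.∈ vertices q → w ∈ T - x
    avoids x∈C w∈q = x∈p∧x≢y⇒x∈p-y (q⊆T w∈q) (λ w≡x → q∉C w∈q (subst (_∈ C) (sym w≡x) x∈C))
    cut : ∀ x → x ∈ T → Connected U (T - x)
    cut x _ with x ∈? C | a ≟ x
    ... | no x∉C | _ = cut-on-ear x x∉C
    ... | yes x∈C | yes refl =
      cut-in-C x x∈C b b∈C (λ b≡a → a≢b (sym b≡a))
        (λ z∈q → to-b z∈q (avoids x∈C) (x∈p∧x≢y⇒x∈p-y (C⊆T b∈C) (λ b≡a → a≢b (sym b≡a))))
    ... | yes x∈C | no a≢x =
      cut-in-C x x∈C a a∈C a≢x (λ z∈q → to-a z∈q (avoids x∈C) (x∈p∧x≢y⇒x∈p-y (C⊆T a∈C) a≢x))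

module _ {n : ℕ} (G : Digraph n) (C : Subset n) (block : Block G C) where

  private
    U : Rel {n}
    U = UAdj G

  no-ear : ∀ {a b s t} → a ∈ C → b ∈ C → a ≢ b → U a s → Walk (∁ C) U s t → U t b → ⊥
  no-ear a∈C b∈C a≢b a-s w t-b =
    q∉C (start∈ q) (proj₂ block T C⊆T biconnected (q⊆T (start∈ q)))
    where
    p : Σ (Path U _ _) λ p → All (_∈ ∁ C) (vertices p)
    p = fromWalk w
    s : Σ (Path U _ _) λ q → Unique (vertices q) × (vertices q ⊆ᴸ vertices (proj₁ p))
    s = simplify (proj₁ p)
    q : Path U _ _
    q = proj₁ s
    q∉C : ∀ {z} → z LM.∈ vertices q → z ∉ C
    q∉C z∈q = x∈∁p⇒x∉p (All.lookup (proj₂ p) (proj₂ (proj₂ s) z∈q))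
    open EarAttachment G C (proj₁ block) a∈C b∈C a≢b a-s q (proj₁ (proj₂ s)) q∉C t-b

  enter-block : ∀ {Y : Subset n} {R : Rel} → (∀ x y → R x y → U x y) → ∀ {s b} →
    Walk Y R s b → b ∈ C →
    (s ∈ C → Walk (Y ∩ C) R s b) ×
    (s ∉ C → Σ (Fin n) λ c → c ∈ C × Σ (Fin n) λ t → Walk (∁ C) U s t × U t c × Walk (Y ∩ C) R c b)
  enter-block R⊆U (here s∈) b∈C = (λ _ → here (x∈p∩q⁺ (s∈ , b∈C))) , (λ s∉C → ⊥-elim (s∉C b∈C))
  enter-block R⊆U {s} (step {y = s'} s∈ r w) b∈C with enter-block R⊆U w b∈C | s' ∈? C
  ... | (stays , _) | yes s'∈C =
    (λ s∈C → step (x∈p∩q⁺ (s∈ , s∈C)) r (stays s'∈C)) ,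
    (λ s∉C → s' , s'∈C , s , here (x∉p⇒x∈∁p s∉C) , R⊆U _ _ r , stays s'∈C)
  ... | (_ , enters) | no s'∉C with enters s'∉C
  ...   | (c , c∈C , t , out , t-c , w-c) =
    re-enter ,
    (λ s∉C → c , c∈C , t , step (x∉p⇒x∈∁p s∉C) (R⊆U _ _ r) out , t-c , w-c)
    where
    -- Leaving C at s and re-entering at c would be an ear unless s ≡ c.
    re-enter : s ∈ C → Walk _ _ s _
    re-enter s∈C with s ≟ c
    ... | yes refl = w-c
    ... | no s≢c = ⊥-elim (no-ear s∈C c∈C s≢c (R⊆U _ _ r) out t-c)

  stay-in-block : ∀ {Y : Subset n} {R : Rel} → (∀ x y → R x y → U x y) → ∀ {a b} →
    Walk Y R a b → a ∈ C → b ∈ C → Walk (Y ∩ C) R a b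
  stay-in-block R⊆U w a∈C b∈C = proj₁ (enter-block R⊆U w b∈C) a∈C

-- Twin removal
--
-- If (x , y) and (y , x) are both edges of a digraph D that is strongly
-- connected on W, and x , y are joined in the underlying graph of D[W]
-- without using the edge {x , y}, then one of the two twin edges can be
-- deleted keeping D strongly connected on W.  Repeating this for all pairs
-- leaves twin pairs only on edges that cannot be bypassed.

false≢true : false ≢ true
false≢true ()

module _ {n : ℕ} where

  deleteEdge : Digraph n → Fin n → Fin n → Digraph n
  deleteEdge D x y p q = if does (p ≟ x) ∧ does (q ≟ y) then false else D p q

  deleteEdge-⊆ : ∀ D x y p q → Edge (deleteEdge D x y) p q → Edge D p q
  deleteEdge-⊆ D x y p q e with p ≟ x | q ≟ y
  ... | yes _ | yes _ = ⊥-elim (false≢true e)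
  ... | yes _ | no _ = e
  ... | no _ | _ = e

  deleteEdge-removes : ∀ D x y → ¬ Edge (deleteEdge D x y) x y
  deleteEdge-removes D x y e with x ≟ x | y ≟ y
  ... | yes _ | yes _ = false≢true e
  ... | no x≢x | _ = x≢x refl
  ... | yes _ | no y≢y = y≢y refl

  deleteEdge-keeps : ∀ D x y p q → Edge D p q → ¬ (p ≡ x × q ≡ y) → Edge (deleteEdge D x y) p q
  deleteEdge-keeps D x y p q e ≢xy with p ≟ x | q ≟ y
  ... | yes p≡x | yes q≡y = ⊥-elim (≢xy (p≡x , q≡y))
  ... | yes _ | no _ = e
  ... | no _ | _ = e

  deleteEdge-uadj : ∀ (D : Digraph n) x y p q → x ≢ y → Edge D y x → UAdj D p q → UAdj (deleteEdge D x y) p q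
  deleteEdge-uadj D x y p q x≢y y→x (p≢q , inj₁ e) = p≢q , keep (p ≟ x) (q ≟ y)
    where
    keep : Dec (p ≡ x) → Dec (q ≡ y) → Edge (deleteEdge D x y) p q ⊎ Edge (deleteEdge D x y) q p
    keep (yes p≡x) (yes q≡y) =
      inj₂ (deleteEdge-keeps D x y q p (subst₂ (Edge D) (sym q≡y) (sym p≡x) y→x)
                               (λ (q≡x , _) → x≢y (trans (sym q≡x) q≡y)))
    keep (yes _) (no q≢y) = inj₁ (deleteEdge-keeps D x y p q e (λ (_ , q≡y) → q≢y q≡y))
    keep (no p≢x) _ = inj₁ (deleteEdge-keeps D x y p q e (λ (p≡x , _) → p≢x p≡x))
  deleteEdge-uadj D x y p q x≢y y→x (p≢q , inj₂ e) =
    uadj-sym (deleteEdge D x y) q p (deleteEdge-uadj D x y q p x≢y y→x (uadj-sym D p q (p≢q , inj₂ e)))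

  module _ (W : Subset n) where

    SC : Digraph n → Set
    SC D = StronglyConnected (Edge D) W

    avoid-deleted : ∀ {D u w a b} → Walk (W - u) (Edge D) a b →
      Walk W (Edge (deleteEdge D u w)) a b × Walk W (Edge (deleteEdge D w u)) a b
    avoid-deleted {D} {u} {w} walk =
      mapʷ (λ _ m → proj₁ (x∈p-y⇒x∈p×x≢y W m))
           (λ p _ p∈ _ e → deleteEdge-keeps D u w p _ e (λ (p≡u , _) → ≢u p∈ p≡u)) walk ,
      mapʷ (λ _ m → proj₁ (x∈p-y⇒x∈p×x≢y W m))
           (λ _ q _ q∈ e → deleteEdge-keeps D w u _ q e (λ (_ , q≡u) → ≢u q∈ q≡u)) walk
      where
      ≢u : ∀ {z} → z ∈ W - u → z ≢ u
      ≢u m = proj₂ (x∈p-y⇒x∈p×x≢y W m)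

    SC-deleteEdge : ∀ D x y → SC D → Walk W (Edge (deleteEdge D x y)) x y → SC (deleteEdge D x y)
    SC-deleteEdge D x y sc x⇝y p q p∈ q∈ = substituteʷ reroute (λ _ m → m) (sc p q p∈ q∈)
      where
      reroute : ∀ a b → a ∈ W → b ∈ W → Edge D a b → Walk W (Edge (deleteEdge D x y)) a b
      reroute a b a∈ b∈ e with a ≟ x | b ≟ y
      ... | yes refl | yes refl = x⇝y
      ... | yes refl | no b≢y = step a∈ (deleteEdge-keeps D x y a b e (λ (_ , b≡y) → b≢y b≡y)) (here b∈)
      ... | no a≢x | _ = step a∈ (deleteEdge-keeps D x y a b e (λ (a≡x , _) → a≢x a≡x)) (here b∈)

    module TwinPair (D : Digraph n) {x y : Fin n} (sc : SC D) (x∈ : x ∈ W) (y∈ : y ∈ W) where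

      A B : Fin n → Set
      A z = Walk W (Edge (deleteEdge D x y)) x z
      B z = Walk W (Edge (deleteEdge D y x)) y z

      A? : Decidable A
      A? = walk? (edge? (deleteEdge D x y)) W x

      -- Assuming neither twin edge can be deleted, every vertex z outside A
      -- lies in B: after its last visit to y, a D-walk from x to z avoids y
      -- and hence both twin edges; the remaining part starts at x (then
      -- z ∈ A) or with an edge y → c with c ≢ x (then z ∈ B).
      module _ (¬Ay : ¬ A y) (¬Bx : ¬ B x) where

        outside-A-in-B : ∀ z → z ∈ W → ¬ A z → B z
        outside-A-in-B z z∈ ¬Az with z ≟ y
        ... | yes refl = here y∈
        ... | no z≢y with avoid-or-exit (sc x z x∈ z∈) z≢y
        ...   | inj₁ x⇝z = ⊥-elim (¬Az (proj₂ (avoid-deleted x⇝z)))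
        ...   | inj₂ (c , y→c , c⇝z) with c ≟ x
        ...     | yes refl = ⊥-elim (¬Az (proj₂ (avoid-deleted c⇝z)))
        ...     | no c≢x = step y∈ (deleteEdge-keeps D y x y c y→c (λ (_ , c≡x) → c≢x c≡x))
                                   (proj₁ (avoid-deleted c⇝z))

        -- A ∩ B is closed under the edges of D: its vertices are neither x
        -- nor y, so their out-edges survive both deletions.
        A∩B-closed : ∀ {p z} → Walk W (Edge D) p z → A p → B p → A z × B z
        A∩B-closed (here _) Ap Bp = Ap , Bp
        A∩B-closed {p} (step {y = c} p∈ e w) Ap Bp with p ≟ x | p ≟ y
        ... | yes refl | _ = ⊥-elim (¬Bx Bp)
        ... | no _ | yes refl = ⊥-elim (¬Ay Ap)
        ... | no p≢x | no p≢y =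
          A∩B-closed w (snocʷ Ap (deleteEdge-keeps D x y p c e (λ (p≡x , _) → p≢x p≡x)) (source w))
                       (snocʷ Bp (deleteEdge-keeps D y x p c e (λ (p≡y , _) → p≢y p≡y)) (source w))

        -- An undirected x–y walk avoiding {x , y} leaves A along an edge
        -- {p , q}; either orientation of it yields a contradiction.
        no-detour : Walk W (WithoutEdge D (x , y)) x y → ⊥
        no-detour detour with firstExit A? detour (here x∈) ¬Ay
        ... | p , q , Ap , ¬Aq , ((_ , orientation) , ≢xy) , p∈ , q∈ with orientation
        ...   | inj₁ p→q = ¬Aq (snocʷ Ap (deleteEdge-keeps D x y p q p→q (λ eq → ≢xy (inj₁ eq))) q∈)
        ...   | inj₂ q→p = ¬Bx (proj₂ (A∩B-closed (sc p x p∈ x∈) Ap Bp))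
          where
          Bp : B p
          Bp = snocʷ (outside-A-in-B q q∈ ¬Aq)
                     (deleteEdge-keeps D y x q p q→p (λ (q≡y , p≡x) → ≢xy (inj₁ (p≡x , q≡y)))) p∈

      delete-twin : Walk W (WithoutEdge D (x , y)) x y → SC (deleteEdge D x y) ⊎ SC (deleteEdge D y x)
      delete-twin detour with A? y | walk? (edge? (deleteEdge D y x)) W y x
      ... | yes Ay | _ = inj₁ (SC-deleteEdge D x y sc Ay)
      ... | no _ | yes Bx = inj₂ (SC-deleteEdge D y x sc Bx)
      ... | no ¬Ay | no ¬Bx = ⊥-elim (no-detour ¬Ay ¬Bx detour)

module IteratedTwinRemoval {n : ℕ} (G : Digraph n) (W : Subset n)
  (Allowed : Rel {n}) (Allowed? : Dec₂ Allowed)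
  (bypass : ∀ x y → x ∈ W → y ∈ W → UAdj G x y → ¬ Allowed x y → Walk W (WithoutEdge G (x , y)) x y) where

  Invariant : Digraph n → Set
  Invariant D = (∀ p q → Edge D p q → Edge G p q) × SC W D × (∀ p q → p ∈ W → q ∈ W → UAdj G p q → UAdj D p q)

  Settled : Digraph n → Fin n × Fin n → Set
  Settled D (x , y) = x ≢ y → x ∈ W → y ∈ W → Edge D x y → Edge D y x → Allowed x y

  settled-⊆ : ∀ D D' → (∀ p q → Edge D' p q → Edge D p q) → ∀ pr → Settled D pr → Settled D' pr
  settled-⊆ D D' D'⊆D (x , y) settled x≢y x∈ y∈ x→y y→x = settled x≢y x∈ y∈ (D'⊆D x y x→y) (D'⊆D y x y→x)

  settle : ∀ D → Invariant D → (pr : Fin n × Fin n) →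
    Σ (Digraph n) λ D' → Invariant D' × (∀ p q → Edge D' p q → Edge D p q) × Settled D' pr
  settle D inv@(D⊆G , sc , same-U) (x , y)
    with x ≟ y | x ∈? W | y ∈? W | edge? D x y | edge? D y x | Allowed? x y
  ... | yes x≡y | _ | _ | _ | _ | _ = D , inv , (λ _ _ e → e) , (λ x≢y → ⊥-elim (x≢y x≡y))
  ... | no _ | no x∉ | _ | _ | _ | _ = D , inv , (λ _ _ e → e) , (λ _ x∈ → ⊥-elim (x∉ x∈))
  ... | no _ | yes _ | no y∉ | _ | _ | _ = D , inv , (λ _ _ e → e) , (λ _ _ y∈ → ⊥-elim (y∉ y∈))
  ... | no _ | yes _ | yes _ | no ¬x→y | _ | _ = D , inv , (λ _ _ e → e) , (λ _ _ _ x→y → ⊥-elim (¬x→y x→y))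
  ... | no _ | yes _ | yes _ | yes _ | no ¬y→x | _ = D , inv , (λ _ _ e → e) , (λ _ _ _ _ y→x → ⊥-elim (¬y→x y→x))
  ... | no _ | yes _ | yes _ | yes _ | yes _ | yes allowed = D , inv , (λ _ _ e → e) , (λ _ _ _ _ _ → allowed)
  ... | no x≢y | yes x∈ | yes y∈ | yes x→y | yes y→x | no ¬allowed
    with TwinPair.delete-twin W D sc x∈ y∈
           (mapʷ (λ _ m → m) (λ p q p∈ q∈ (u , ≢xy) → same-U p q p∈ q∈ u , ≢xy)
                 (bypass x y x∈ y∈ (x≢y , inj₁ (D⊆G x y x→y)) ¬allowed))
  ... | inj₁ sc' =
    deleteEdge D x y ,
    ((λ p q e → D⊆G p q (deleteEdge-⊆ D x y p q e)) , sc' ,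
     λ p q p∈ q∈ u → deleteEdge-uadj D x y p q x≢y y→x (same-U p q p∈ q∈ u)) ,
    deleteEdge-⊆ D x y , (λ _ _ _ e → ⊥-elim (deleteEdge-removes D x y e))
  ... | inj₂ sc' =
    deleteEdge D y x ,
    ((λ p q e → D⊆G p q (deleteEdge-⊆ D y x p q e)) , sc' ,
     λ p q p∈ q∈ u → deleteEdge-uadj D y x p q (λ y≡x → x≢y (sym y≡x)) x→y (same-U p q p∈ q∈ u)) ,
    deleteEdge-⊆ D y x , (λ _ _ _ _ e → ⊥-elim (deleteEdge-removes D y x e))

  settle-all : (ps : List (Fin n × Fin n)) → SC W G → Σ (Digraph n) λ D → Invariant D × All (Settled D) ps
  settle-all [] sc = G , ((λ _ _ e → e) , sc , (λ _ _ _ _ u → u)) , []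
  settle-all (pr ∷ ps) sc with settle-all ps sc
  ... | D , inv , settled with settle D inv pr
  ...   | D' , inv' , D'⊆D , settled-pr =
    D' , inv' , (settled-pr ∷ All.map (λ {pr'} → settled-⊆ D D' D'⊆D pr') settled)

  twin-free-up-to-allowed : SC W G →
    Σ (Digraph n) λ D → Invariant D × (∀ x y → x ≢ y → x ∈ W → y ∈ W → Edge D x y → Edge D y x → Allowed x y)
  twin-free-up-to-allowed sc with settle-all (cartesianProduct (allFin n) (allFin n)) sc
  ... | D , inv , settled =
    D , inv , λ x y → All.lookup settled (LMP.∈-cartesianProduct⁺ (LMP.∈-allFin x) (LMP.∈-allFin y))

-- Strongly connected components.  The SCC of x in G[W] is the set of
-- vertices mutually reachable with x inside W; these sets are exactly the
-- SCCs, and they can be counted via their least elements.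

module SCCs {n : ℕ} (G : Digraph n) (W : Subset n) where

  private
    E : Rel {n}
    E = Edge G

  mutual? : ∀ x z → Dec (Walk W E x z × Walk W E z x)
  mutual? x z = walk? (edge? G) W x z ×-dec walk? (edge? G) W z x

  sccOf : Fin n → Subset n
  sccOf x = subsetOf (mutual? x)

  x∈sccOf : ∀ {x} → x ∈ W → x ∈ sccOf x
  x∈sccOf x∈ = ∈subsetOf⁺ (mutual? _) (here x∈ , here x∈)

  stays-in-scc : ∀ {x a b} → Walk W E a b → Walk W E x a → Walk W E b x → Walk (sccOf x) E a b
  stays-in-scc (here a∈) x⇝a b⇝x = here (∈subsetOf⁺ (mutual? _) (x⇝a , b⇝x))
  stays-in-scc (step a∈ e w) x⇝a b⇝x =
    step (∈subsetOf⁺ (mutual? _) (x⇝a , step a∈ e w ++ʷ b⇝x)) e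
         (stays-in-scc w (snocʷ x⇝a e (source w)) b⇝x)

  sccOf-SC : ∀ x → StronglyConnected E (sccOf x)
  sccOf-SC x p q p∈ q∈ =
    let (x⇝p , p⇝x) = ∈subsetOf⁻ (mutual? x) p∈
        (x⇝q , q⇝x) = ∈subsetOf⁻ (mutual? x) q∈
    in stays-in-scc (p⇝x ++ʷ x⇝q) x⇝p q⇝x

  sccOf-SCC : ∀ x → x ∈ W → SCC G W (sccOf x)
  sccOf-SCC x x∈ =
    (λ m → target (proj₁ (∈subsetOf⁻ (mutual? x) m))) , (x , x∈sccOf x∈) , sccOf-SC x ,
    λ T S⊆T T⊆W sc {z} z∈ →
      let x∈T = S⊆T (x∈sccOf x∈)
          inW = mapʷ (λ _ m → T⊆W m) (λ _ _ _ _ e → e)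
      in ∈subsetOf⁺ (mutual? x) (inW (sc x z x∈T z∈) , inW (sc z x z∈ x∈T))

  Representative : Fin n → Set
  Representative z = z ∈ W × (∀ w → w ∈ sccOf z → z F.≤ w)

  representative? : Decidable Representative
  representative? z = (z ∈? W) ×-dec all? (λ w → (w ∈? sccOf z) →-dec (z FP.≤? w))

  scc-represented : ∀ S → SCC G W S → ∃[ r ] (Representative r × S ≡ sccOf r)
  scc-represented S (S⊆W , (x , x∈S) , sc , maximal) = r , (r∈ , r-least) , subset-ext S⊆r r⊆S
    where
    x∈ : x ∈ W
    x∈ = S⊆W x∈S
    least-mutual : Σ (Fin n) λ r → (Walk W E x r × Walk W E r x) × (∀ w → Walk W E x w × Walk W E w x → r F.≤ w)
    least-mutual = least (mutual? x) (x , here x∈ , here x∈)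
    r : Fin n
    r = proj₁ least-mutual
    x⇝r : Walk W E x r
    x⇝r = proj₁ (proj₁ (proj₂ least-mutual))
    r⇝x : Walk W E r x
    r⇝x = proj₂ (proj₁ (proj₂ least-mutual))
    r∈ : r ∈ W
    r∈ = target x⇝r
    r-least : ∀ w → w ∈ sccOf r → r F.≤ w
    r-least w m = let (r⇝w , w⇝r) = ∈subsetOf⁻ (mutual? r) m in
      proj₂ (proj₂ least-mutual) w (x⇝r ++ʷ r⇝w , w⇝r ++ʷ r⇝x)
    inW : ∀ {a b} → Walk S E a b → Walk W E a b
    inW = mapʷ (λ _ m → S⊆W m) (λ _ _ _ _ e → e)
    S⊆r : ∀ z → z ∈ S → z ∈ sccOf r
    S⊆r z z∈ = ∈subsetOf⁺ (mutual? r) (r⇝x ++ʷ inW (sc x z x∈S z∈) , inW (sc z x z∈ x∈S) ++ʷ x⇝r)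
    sccOf-x⊆S : sccOf x ⊆ S
    sccOf-x⊆S = maximal (sccOf x)
      (λ {z} z∈ → ∈subsetOf⁺ (mutual? x) (inW (sc x z x∈S z∈) , inW (sc z x z∈ x∈S)))
      (proj₁ (sccOf-SCC x x∈)) (sccOf-SC x)
    r⊆S : ∀ z → z ∈ sccOf r → z ∈ S
    r⊆S z m = let (r⇝z , z⇝r) = ∈subsetOf⁻ (mutual? r) m in
      sccOf-x⊆S (∈subsetOf⁺ (mutual? x) (x⇝r ++ʷ r⇝z , z⇝r ++ʷ r⇝x))

  count-SCCs : ∃[ k ] NumSCC G W k
  count-SCCs =
    let (k , reps) = count-decidable representative? in
    k , count-image sccOf reps same-scc scc-represented (λ r (r∈ , _) → sccOf-SCC r r∈)
    where
    same-scc : ∀ a b → Representative a → Representative b → sccOf a ≡ sccOf b → a ≡ b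
    same-scc a b (a∈ , a-least) (b∈ , b-least) eq =
      FP.≤-antisym (a-least b (subst (b ∈_) (sym eq) (x∈sccOf b∈)))
                   (b-least a (subst (a ∈_) eq (x∈sccOf a∈)))

one-SCC : ∀ {n} (G : Digraph n) → StronglyConnected (Edge G) ⊤ → (v : Fin n) → NumSCC G ⊤ 1
one-SCC G sc v =
  count-unique ⊤ (λ S (S⊆ , _ , _ , maximal) → subset-ext (λ _ m → S⊆ m) (λ _ m → maximal ⊤ S⊆ (λ m' → m') sc m))
               ((λ {_} m → m) , (v , ∈⊤) , sc , λ T _ T⊆ _ → T⊆)

-- Deleting a vertex v that is not a strong articulation point from a
-- strongly connected digraph leaves it strongly connected: otherwise G - v
-- has two distinct SCCs, while G has one.
SC-minus-non-SAP : ∀ {n} (G : Digraph n) (v : Fin n) → StronglyConnected (Edge G) ⊤ →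
  ¬ StrongArticulationPoint G v → StronglyConnected (Edge G) (⊤ - v)
SC-minus-non-SAP G v sc ¬SAP x y x∈ y∈ =
  decidable-stable (walk? (edge? G) (⊤ - v) x y) λ ¬x⇝y →
    let (k , count) = count-SCCs in
    ¬SAP (1 , k , one-SCC G sc v , count ,
          two≤count count (sccOf-SCC x x∈) (sccOf-SCC y y∈)
            (λ eq → ¬x⇝y (proj₁ (∈subsetOf⁻ (mutual? x) (subst (y ∈_) (sym eq) (x∈sccOf y∈))))))
  where
  open SCCs G (⊤ - v)

twinless⇒strong : ∀ {n} (G : Digraph n) {S} → TwinlessSC G S → StronglyConnected (Edge G) S
twinless⇒strong G (F , F⊆G , _ , sc) x y x∈ y∈ = mapʷ (λ _ m → m) (λ p q _ _ → F⊆G p q) (sc x y x∈ y∈)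

-- Removing bridges
--
-- Removing a list M of k
-- distinct bridges of a connected R[W] leaves exactly k + 1 components
-- (counted through their least vertices).

module BridgeRemoval {n : ℕ} (R : Rel {n}) (R? : Dec₂ R) (R-sym : Symmetric R) (W : Subset n) where

  open DecLM (ProductP.≡-dec (_≟_ {n}) (_≟_ {n})) using () renaming (_∈?_ to _∈ᴾ?_)

  Listed : List (Fin n × Fin n) → Rel {n}
  Listed M p q = (p , q) LM.∈ M ⊎ (q , p) LM.∈ M

  listed? : ∀ M → Dec₂ (Listed M)
  listed? M p q = ((p , q) ∈ᴾ? M) ⊎-dec ((q , p) ∈ᴾ? M)

  Minus : List (Fin n × Fin n) → Rel {n}
  Minus M p q = R p q × ¬ Listed M p q

  minus? : ∀ M → Dec₂ (Minus M)
  minus? M p q = R? p q ×-dec ¬? (listed? M p q)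

  minus-sym : ∀ M → Symmetric (Minus M)
  minus-sym M p q (r , ¬listed) = R-sym p q r , λ { (inj₁ m) → ¬listed (inj₂ m) ; (inj₂ m) → ¬listed (inj₁ m) }

  Without : Fin n × Fin n → Rel {n}
  Without (a , b) x y = R x y × ¬ ((x ≡ a × y ≡ b) ⊎ (x ≡ b × y ≡ a))

  without? : ∀ e → Dec₂ (Without e)
  without? (a , b) x y = R? x y ×-dec ¬? ((x ≟ a ×-dec y ≟ b) ⊎-dec (x ≟ b ×-dec y ≟ a))

  without-sym : ∀ e → Symmetric (Without e)
  without-sym e p q (r , ≢e) =
    R-sym p q r , λ { (inj₁ (q≡ , p≡)) → ≢e (inj₂ (p≡ , q≡)) ; (inj₂ (q≡ , p≡)) → ≢e (inj₁ (p≡ , q≡)) }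

  without-flip : ∀ {a b} p q → Without (a , b) p q → Without (b , a) p q
  without-flip p q (r , ≢e) = r , λ { (inj₁ eq) → ≢e (inj₂ eq) ; (inj₂ eq) → ≢e (inj₁ eq) }

  removed-edge : ∀ {a b x y} → R x y → ¬ Without (a , b) x y → (x ≡ a × y ≡ b) ⊎ (x ≡ b × y ≡ a)
  removed-edge {a} {b} {x} {y} r ¬kept =
    decidable-stable ((x ≟ a ×-dec y ≟ b) ⊎-dec (x ≟ b ×-dec y ≟ a)) (λ ≢e → ¬kept (r , ≢e))

  bypass-every-edge : ∀ {S a b} → Walk S (Without (a , b)) a b →
    ∀ x y → x ∈ S → y ∈ S → R x y → Walk S (Without (a , b)) x y
  bypass-every-edge {a = a} {b} bypass x y x∈ y∈ r with without? (a , b) x y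
  ... | yes kept = step x∈ kept (here y∈)
  ... | no ¬kept with removed-edge r ¬kept
  ...   | inj₁ (refl , refl) = bypass
  ...   | inj₂ (refl , refl) = reverseʷ (without-sym (a , b)) bypass

  Reach : List (Fin n × Fin n) → Fin n → Fin n → Set
  Reach M = Walk W (Minus M)

  reach-sym : ∀ {M x y} → Reach M x y → Reach M y x
  reach-sym {M} = reverseʷ (minus-sym M)

  reach-drop : ∀ {e M p q} → Reach (e ∷ M) p q → Reach M p q
  reach-drop = mapʷ (λ _ m → m) (λ _ _ _ _ (r , ¬listed) →
    r , λ { (inj₁ m) → ¬listed (inj₁ (there m)) ; (inj₂ m) → ¬listed (inj₂ (there m)) })

  reach-without : ∀ {a b M} → (a , b) LM.∈ M → ∀ {p q} → Reach M p q → Walk W (Without (a , b)) p q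
  reach-without ab∈M = mapʷ (λ _ m → m) (λ _ _ _ _ (r , ¬listed) →
    r , λ { (inj₁ (refl , refl)) → ¬listed (inj₁ ab∈M) ; (inj₂ (refl , refl)) → ¬listed (inj₂ ab∈M) })

  reach-none : ∀ {p q} → Walk W R p q → Reach [] p q
  reach-none = mapʷ (λ _ m → m) (λ _ _ _ _ r → r , λ { (inj₁ ()) ; (inj₂ ()) })

  component : List (Fin n × Fin n) → Fin n → Subset n
  component M x = subsetOf (walk? (minus? M) W x)

  ∈component⁺ : ∀ M x {z} → Reach M x z → z ∈ component M x
  ∈component⁺ M x = ∈subsetOf⁺ (walk? (minus? M) W x)

  ∈component⁻ : ∀ M x {z} → z ∈ component M x → Reach M x z
  ∈component⁻ M x = ∈subsetOf⁻ (walk? (minus? M) W x)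

  component⊆W : ∀ M x {z} → z ∈ component M x → z ∈ W
  component⊆W M x m = target (∈component⁻ M x m)

  leastReach : ∀ M {x} → x ∈ W → Σ (Fin n) λ r → Reach M x r × (∀ w → Reach M x w → r F.≤ w)
  leastReach M {x} x∈ = least (walk? (minus? M) W x) (x , here x∈)

  Bridge : Fin n × Fin n → Set
  Bridge (a , b) = a ∈ W × b ∈ W × R a b × ¬ Walk W (Without (a , b)) a b

  Representative : List (Fin n × Fin n) → Fin n → Set
  Representative M z = z ∈ W × (∀ w → Reach M z w → z F.≤ w)

  cross-split : ∀ a b M {p q} → Reach M p q →
    Reach ((a , b) ∷ M) p q ⊎ (Reach ((a , b) ∷ M) p a × Reach ((a , b) ∷ M) b q)
                            ⊎ (Reach ((a , b) ∷ M) p b × Reach ((a , b) ∷ M) a q)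
  cross-split a b M (here p∈) = inj₁ (here p∈)
  cross-split a b M {p} (step {y = c} p∈ (r , ¬listed) w) with cross-split a b M w | listed? ((a , b) ∷ M) p c
  ... | rest | no ¬listed' with rest
  ...   | inj₁ w' = inj₁ (step p∈ (r , ¬listed') w')
  ...   | inj₂ (inj₁ (c⇝a , b⇝q)) = inj₂ (inj₁ (step p∈ (r , ¬listed') c⇝a , b⇝q))
  ...   | inj₂ (inj₂ (c⇝b , a⇝q)) = inj₂ (inj₂ (step p∈ (r , ¬listed') c⇝b , a⇝q))
  cross-split a b M {p} (step p∈ (r , ¬listed) w) | rest | yes (inj₁ (there m)) = ⊥-elim (¬listed (inj₁ m))
  cross-split a b M {p} (step p∈ (r , ¬listed) w) | rest | yes (inj₂ (there m)) = ⊥-elim (¬listed (inj₂ m))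
  cross-split a b M {p} (step p∈ _ w) | rest | yes (inj₁ (here refl)) with rest
  ...   | inj₁ b⇝q = inj₂ (inj₁ (here p∈ , b⇝q))
  ...   | inj₂ (inj₁ (_ , b⇝q)) = inj₂ (inj₁ (here p∈ , b⇝q))
  ...   | inj₂ (inj₂ (_ , a⇝q)) = inj₁ a⇝q
  cross-split a b M {p} (step p∈ _ w) | rest | yes (inj₂ (here refl)) with rest
  ...   | inj₁ a⇝q = inj₂ (inj₂ (here p∈ , a⇝q))
  ...   | inj₂ (inj₁ (_ , b⇝q)) = inj₁ b⇝q
  ...   | inj₂ (inj₂ (_ , a⇝q)) = inj₂ (inj₂ (here p∈ , a⇝q))

  -- Passing from M' to M removes one more edge {c , d}: M-walks are
  -- M'-walks, and M'-walks split at {c , d}.  If this disconnects c from d,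
  -- it adds exactly one representative, the least vertex r of the new
  -- component of d.  Here m is the representative of c under M', and m
  -- stays on the side of c.
  one-more-bridge : ∀ M M' {k} (c d m : Fin n) → d ∈ W →
    (∀ {p q} → Reach M p q → Reach M' p q) →
    (∀ {p q} → Reach M' p q → Reach M p q ⊎ (Reach M p c × Reach M d q) ⊎ (Reach M p d × Reach M c q)) →
    Reach M' c d → ¬ Reach M c d → Reach M m c → (∀ w → Reach M' c w → m F.≤ w) →
    Count (Representative M') k → Count (Representative M) (suc k)
  one-more-bridge M M' c d m d∈ shrink split c⇝'d ¬c⇝d m⇝c m-least count =
    count-suc r count old-or-new (λ z (z∈ , z-least) → z∈ , λ w z⇝w → z-least w (shrink z⇝w))
              (r∈ , r-least) r-new
    where
    r : Fin n
    r = proj₁ (leastReach M d∈)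
    d⇝r : Reach M d r
    d⇝r = proj₁ (proj₂ (leastReach M d∈))
    r≤ : ∀ w → Reach M d w → r F.≤ w
    r≤ = proj₂ (proj₂ (leastReach M d∈))
    r∈ : r ∈ W
    r∈ = target d⇝r
    r-least : ∀ w → Reach M r w → r F.≤ w
    r-least w r⇝w = r≤ w (d⇝r ++ʷ r⇝w)
    -- Before the removal r and m were in the same component, so a common
    -- representative would make them equal and connect c to d.
    r-new : ¬ Representative M' r
    r-new (_ , r-least') = ¬c⇝d (reach-sym m⇝c ++ʷ subst (λ z → Reach M z d) r≡m (reach-sym d⇝r))
      where
      r≡m : r ≡ m
      r≡m = FP.≤-antisym (r-least' m (shrink (reach-sym d⇝r) ++ʷ reach-sym c⇝'d ++ʷ shrink (reach-sym m⇝c)))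
                         (m-least r (c⇝'d ++ʷ shrink d⇝r))
    -- A vertex that still reaches c (and is least on its side) is no
    -- larger than m, hence was a representative before the removal.
    via-c : ∀ z → Representative M z → Reach M' z c → Reach M z c → Representative M' z
    via-c z (z∈ , z-least) z⇝'c z⇝c = z∈ , λ w z⇝'w →
      FP.≤-trans {i = z} {j = m} {k = w} (z-least m (z⇝c ++ʷ reach-sym m⇝c))
                 (m-least w (reach-sym {M'} z⇝'c ++ʷ z⇝'w))
    old-or-new : ∀ z → Representative M z → Representative M' z ⊎ z ≡ r
    old-or-new z rep@(z∈ , z-least) with walk? (minus? M') W z c
    ... | yes z⇝'c with split z⇝'c
    ...   | inj₂ (inj₂ (z⇝d , _)) = inj₂ (FP.≤-antisym (z-least r (z⇝d ++ʷ d⇝r)) (r≤ z (reach-sym z⇝d)))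
    ...   | inj₁ z⇝c = inj₁ (via-c z rep z⇝'c z⇝c)
    ...   | inj₂ (inj₁ (z⇝c , _)) = inj₁ (via-c z rep z⇝'c z⇝c)
    old-or-new z (z∈ , z-least) | no ¬z⇝'c = inj₁ (z∈ , λ w z⇝'w → uncrossed w (split z⇝'w))
      where
      uncrossed : ∀ w → Reach M z w ⊎ (Reach M z c × Reach M d w) ⊎ (Reach M z d × Reach M c w) → z F.≤ w
      uncrossed w (inj₁ z⇝w) = z-least w z⇝w
      uncrossed w (inj₂ (inj₁ (z⇝c , _))) = ⊥-elim (¬z⇝'c (shrink z⇝c))
      uncrossed w (inj₂ (inj₂ (z⇝d , _))) = ⊥-elim (¬z⇝'c (shrink z⇝d ++ʷ reach-sym {M'} c⇝'d))

  module _ (connected : Connected R W) {w₀ : Fin n} (w₀∈ : w₀ ∈ W) where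

    one-component : Count (Representative []) 1
    one-component =
      count-unique m (λ z (z∈ , z-least) → FP.≤-antisym (z-least m (reach-none (connected z m z∈ m∈))) (m≤ z z∈))
                     (m∈ , λ w m⇝w → m≤ w (target m⇝w))
      where
      m : Fin n
      m = proj₁ (least (_∈? W) (w₀ , w₀∈))
      m∈ : m ∈ W
      m∈ = proj₁ (proj₂ (least (_∈? W) (w₀ , w₀∈)))
      m≤ : ∀ z → z ∈ W → m F.≤ z
      m≤ = proj₂ (proj₂ (least (_∈? W) (w₀ , w₀∈)))

    count-representatives : ∀ M → Unique M → (∀ {e} → e LM.∈ M → Bridge e) →
      (∀ {a b} → (a , b) LM.∈ M → toℕ a ℕ.< toℕ b) → Count (Representative M) (suc (length M))
    count-representatives [] _ _ _ = one-component
    count-representatives ((a , b) ∷ M') (ab∉M' ∷ unique) bridges oriented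
      with bridges (here refl)
    ... | a∈ , b∈ , a-b , ¬bypass = by-side-of-m (cross-split a b M' (reach-sym a⇝'m))
      where
      M : List (Fin n × Fin n)
      M = (a , b) ∷ M'
      before : Count (Representative M') (suc (length M'))
      before = count-representatives M' unique (λ m → bridges (there m)) (λ m → oriented (there m))
      ba∉M' : ¬ (b , a) LM.∈ M'
      ba∉M' ba∈M' = ℕP.<-asym (oriented (here refl)) (oriented (there ba∈M'))
      a⇝'b : Reach M' a b
      a⇝'b = step a∈ (a-b , [ (λ m → All.lookup ab∉M' m refl) , ba∉M' ]′) (here b∈)
      ¬a⇝b : ¬ Reach M a b
      ¬a⇝b w = ¬bypass (reach-without (here refl) w)
      m : Fin n
      m = proj₁ (leastReach M' a∈)
      a⇝'m : Reach M' a m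
      a⇝'m = proj₁ (proj₂ (leastReach M' a∈))
      m-least : ∀ w → Reach M' a w → m F.≤ w
      m-least = proj₂ (proj₂ (leastReach M' a∈))
      on-a-side : Reach M m a → Count (Representative M) (suc (suc (length M')))
      on-a-side m⇝a = one-more-bridge M M' a b m b∈ reach-drop (cross-split a b M') a⇝'b ¬a⇝b m⇝a m-least before
      on-b-side : Reach M m b → Count (Representative M) (suc (suc (length M')))
      on-b-side m⇝b =
        one-more-bridge M M' b a m a∈ reach-drop swap-split (reach-sym a⇝'b) (λ w → ¬a⇝b (reach-sym w)) m⇝b
                   (λ w b⇝w → m-least w (a⇝'b ++ʷ b⇝w)) before
        where
        swap-split : ∀ {p q} → Reach M' p q → Reach M p q ⊎ (Reach M p b × Reach M a q) ⊎ (Reach M p a × Reach M b q)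
        swap-split w with cross-split a b M' w
        ... | inj₁ x = inj₁ x
        ... | inj₂ (inj₁ x) = inj₂ (inj₂ x)
        ... | inj₂ (inj₂ x) = inj₂ (inj₁ x)
      by-side-of-m : Reach M m a ⊎ (Reach M m a × Reach M b a) ⊎ (Reach M m b × Reach M a a) →
        Count (Representative M) (suc (suc (length M')))
      by-side-of-m (inj₁ m⇝a) = on-a-side m⇝a
      by-side-of-m (inj₂ (inj₁ (m⇝a , _))) = on-a-side m⇝a
      by-side-of-m (inj₂ (inj₂ (m⇝b , _))) = on-b-side m⇝b

  count-components : ∀ M {k} (P : Subset n → Set) →
    (∀ S → P S → ∃[ x ] (x ∈ W × S ≡ component M x)) → (∀ x → x ∈ W → P (component M x)) →
    Count (Representative M) k → Count P k
  count-components M P is-component component-P reps = count-image (component M) reps injective onto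
    (λ r (r∈ , _) → component-P r r∈)
    where
    injective : ∀ r₁ r₂ → Representative M r₁ → Representative M r₂ → component M r₁ ≡ component M r₂ → r₁ ≡ r₂
    injective r₁ r₂ (r₁∈ , r₁-least) (r₂∈ , r₂-least) eq =
      FP.≤-antisym (r₁-least r₂ (∈component⁻ M r₁ (subst (r₂ ∈_) (sym eq) (∈component⁺ M r₂ (here r₂∈)))))
                   (r₂-least r₁ (∈component⁻ M r₂ (subst (r₁ ∈_) eq (∈component⁺ M r₁ (here r₁∈)))))
    onto : ∀ S → P S → ∃[ r ] (Representative M r × S ≡ component M r)
    onto S PS with is-component S PS
    ... | x , x∈ , refl = r , (target x⇝r , λ w r⇝w → r-least w (x⇝r ++ʷ r⇝w)) ,
        subset-ext (λ z z∈ → ∈component⁺ M r (reach-sym x⇝r ++ʷ ∈component⁻ M x z∈))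
                   (λ z z∈ → ∈component⁺ M x (x⇝r ++ʷ ∈component⁻ M r z∈))
      where
      r : Fin n
      r = proj₁ (leastReach M x∈)
      x⇝r : Reach M x r
      x⇝r = proj₁ (proj₂ (leastReach M x∈))
      r-least : ∀ w → Reach M x w → r F.≤ w
      r-least = proj₂ (proj₂ (leastReach M x∈))

  listed-element : ∀ {M p q} → Listed M p q →
    Σ (Fin n × Fin n) λ e → e LM.∈ M × ((proj₁ e ≡ p × proj₂ e ≡ q) ⊎ (proj₁ e ≡ q × proj₂ e ≡ p))
  listed-element {p = p} {q} (inj₁ pq∈) = (p , q) , pq∈ , inj₁ (refl , refl)
  listed-element {p = p} {q} (inj₂ qp∈) = (q , p) , qp∈ , inj₂ (refl , refl)

  module _ (F : Rel {n}) (F⊆R : ∀ p q → p ≢ q → F p q → R p q) (twin-free : ∀ p q → ¬ (F p q × F q p))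
    {T : Subset n} (T⊆W : ∀ z → z ∈ T → z ∈ W) (F-sc : StronglyConnected F T) where

    private
      F-irreflexive : ∀ {p q} → F p q → p ≢ q
      F-irreflexive {p} e refl = twin-free p p (e , e)

    -- A twin-free relation strongly connected on T never uses a bridge
    -- {a , b} of R[W] inside T: going back from q to p it would have to
    -- cross the bridge again, in the opposite direction.
    no-bridge-inside : ∀ {a b p q} → Bridge (a , b) → F p q → p ∈ T → q ∈ T →
      (p ≡ a × q ≡ b) ⊎ (p ≡ b × q ≡ a) → ⊥
    no-bridge-inside {a} {b} {p} {q} (_ , _ , _ , ¬bypass) p→q p∈ q∈ is-ab =
      back-across (firstExit (λ z → ¬? (X? z)) (F-sc q p q∈ p∈) ¬Xq (λ ¬Xp → ¬Xp (here (T⊆W p p∈))))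
      where
      X? : Decidable (Walk W (Without (a , b)) p)
      X? = walk? (without? (a , b)) W p
      ¬Xq : ¬ Walk W (Without (a , b)) p q
      ¬Xq w = ¬bypass ([ (λ (p≡a , q≡b) → subst₂ (Walk W (Without (a , b))) p≡a q≡b w)
                       , (λ (p≡b , q≡a) → subst₂ (Walk W (Without (a , b))) q≡a p≡b (reverseʷ (without-sym _) w)) ]′ is-ab)
      same-or-reversed : ∀ {s t} → (s ≡ a × t ≡ b) ⊎ (s ≡ b × t ≡ a) → (s ≡ p × t ≡ q) ⊎ (s ≡ q × t ≡ p)
      same-or-reversed (inj₁ (s≡a , t≡b)) =
        [ (λ (p≡a , q≡b) → inj₁ (trans s≡a (sym p≡a) , trans t≡b (sym q≡b)))
        , (λ (p≡b , q≡a) → inj₂ (trans s≡a (sym q≡a) , trans t≡b (sym p≡b))) ]′ is-ab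
      same-or-reversed (inj₂ (s≡b , t≡a)) =
        [ (λ (p≡a , q≡b) → inj₂ (trans s≡b (sym q≡b) , trans t≡a (sym p≡a)))
        , (λ (p≡b , q≡a) → inj₁ (trans s≡b (sym p≡b) , trans t≡a (sym q≡a))) ]′ is-ab
      back-across : ∃[ s ] ∃[ t ] (¬ Walk W (Without (a , b)) p s × ¬ ¬ Walk W (Without (a , b)) p t ×
                                   F s t × s ∈ T × t ∈ T) → ⊥
      back-across (s , t , ¬Xs , ¬¬Xt , s→t , s∈ , t∈) with without? (a , b) s t
      ... | yes kept = ¬Xs (snocʷ (decidable-stable (X? t) ¬¬Xt) (without-sym _ s t kept) (T⊆W s s∈))
      ... | no ¬kept with same-or-reversed (removed-edge (F⊆R s t (F-irreflexive s→t) s→t) ¬kept)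
      ...   | inj₁ (_ , t≡q) = ¬Xq (subst (Walk W (Without (a , b)) p) t≡q (decidable-stable (X? t) ¬¬Xt))
      ...   | inj₂ (s≡q , t≡p) = twin-free p q (p→q , subst₂ F s≡q t≡p s→t)
    within-component : ∀ M → (∀ {e} → e LM.∈ M → Bridge e) → ∀ {x y} → x ∈ T → y ∈ T → Reach M x y
    within-component M bridges {x} {y} x∈ y∈ with walk? (minus? M) W x y
    ... | yes x⇝y = x⇝y
    ... | no ¬x⇝y with firstExit (walk? (minus? M) W x) (F-sc x y x∈ y∈) (here (T⊆W x x∈)) ¬x⇝y
    ...   | p , q , x⇝p , ¬x⇝q , p→q , p∈ , q∈ with listed? M p q
    ...     | no ¬listed = ⊥-elim (¬x⇝q (snocʷ x⇝p (F⊆R p q (F-irreflexive p→q) p→q , ¬listed) (T⊆W q q∈)))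
    ...     | yes listed with listed-element listed
    ...       | (a , b) , e∈ , is-ab = ⊥-elim (no-bridge-inside (bridges e∈) p→q p∈ q∈
                  ([ (λ (a≡p , b≡q) → inj₁ (sym a≡p , sym b≡q))
                   , (λ (a≡q , b≡p) → inj₂ (sym b≡p , sym a≡q)) ]′ is-ab))

  -- A relation D ⊆ R strongly connected on W stays strongly connected on
  -- every component once the bridges of M are removed from it too: each
  -- removed bridge is the only edge between the two sides it separates, so
  -- walks can be shortened to stay on one side.
  module _ (connected : Connected R W) (D : Rel {n}) (D⊆R : ∀ p q → p ≢ q → D p q → R p q)
    (D-sc : StronglyConnected D W) where

    DMinus : List (Fin n × Fin n) → Rel {n}
    DMinus M p q = D p q × ¬ Listed M p q

    -- One removal step: the component Y of x under M shrinks to the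
    -- component S of x under (a , b) ∷ M.
    module Shrink (a b : Fin n) (M : List (Fin n × Fin n)) (bridge : Bridge (a , b)) (x : Fin n) where

      S Y : Subset n
      S = component ((a , b) ∷ M) x
      Y = component M x

      S⊆Y : ∀ {z} → z ∈ S → z ∈ Y
      S⊆Y z∈ = ∈component⁺ M x (reach-drop (∈component⁻ ((a , b) ∷ M) x z∈))

      not-both : a ∈ S → b ∈ S → ⊥
      not-both a∈ b∈ = proj₂ (proj₂ (proj₂ bridge))
        (reach-without (here refl) (reach-sym (∈component⁻ _ x a∈) ++ʷ ∈component⁻ _ x b∈))

      inside-S : ∀ p q → p ∈ S → q ∈ S → DMinus M p q → DMinus ((a , b) ∷ M) p q
      inside-S p q p∈ q∈ (d , ¬listed) = d , λ
        { (inj₁ (here refl)) → not-both p∈ q∈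
        ; (inj₂ (here refl)) → not-both q∈ p∈
        ; (inj₁ (there m)) → ¬listed (inj₁ m)
        ; (inj₂ (there m)) → ¬listed (inj₂ m) }

      crossing : ∀ p q → p ∈ Y → q ∈ Y → DMinus M p q → (p ∈ S × q ∉ S) ⊎ (p ∉ S × q ∈ S) →
        (p ≡ a × q ≡ b) ⊎ (p ≡ b × q ≡ a)
      crossing p q p∈Y q∈Y (d , ¬listed) side with listed? ((a , b) ∷ M) p q
      ... | yes (inj₁ (here refl)) = inj₁ (refl , refl)
      ... | yes (inj₂ (here refl)) = inj₂ (refl , refl)
      ... | yes (inj₁ (there m)) = ⊥-elim (¬listed (inj₁ m))
      ... | yes (inj₂ (there m)) = ⊥-elim (¬listed (inj₂ m))
      ... | no ¬listed' = ⊥-elim (joined side)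
        where
        p≢q : p ≢ q
        p≢q refl = [ (λ (p∈ , p∉) → p∉ p∈) , (λ (p∉ , p∈) → p∉ p∈) ]′ side
        r : Minus ((a , b) ∷ M) p q
        r = D⊆R p q p≢q d , ¬listed'
        joined : (p ∈ S × q ∉ S) ⊎ (p ∉ S × q ∈ S) → ⊥
        joined (inj₁ (p∈ , q∉)) = q∉ (∈component⁺ _ x (snocʷ (∈component⁻ _ x p∈) r (component⊆W M x q∈Y)))
        joined (inj₂ (p∉ , q∈)) =
          p∉ (∈component⁺ _ x (snocʷ (∈component⁻ _ x q∈) (minus-sym _ p q r) (component⊆W M x p∈Y)))

      -- Hence all crossing edges meet S in a single vertex: a if a ∈ S,
      -- otherwise b.
      attachment : Dec (a ∈ S) → Fin n
      attachment (yes _) = a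
      attachment (no _) = b

      attached : (a∈? : Dec (a ∈ S)) → ∀ p q → p ∈ Y → q ∈ Y → DMinus M p q →
        (p ∈ S → q ∉ S → p ≡ attachment a∈?) × (p ∉ S → q ∈ S → q ≡ attachment a∈?)
      attached (yes a∈) p q p∈Y q∈Y d =
        (λ p∈ q∉ → [ proj₁ , (λ (_ , q≡a) → ⊥-elim (q∉ (subst (_∈ S) (sym q≡a) a∈))) ]′
                     (crossing p q p∈Y q∈Y d (inj₁ (p∈ , q∉)))) ,
        (λ p∉ q∈' → [ (λ (p≡a , _) → ⊥-elim (p∉ (subst (_∈ S) (sym p≡a) a∈))) , proj₂ ]′
                      (crossing p q p∈Y q∈Y d (inj₂ (p∉ , q∈'))))
      attached (no a∉) p q p∈Y q∈Y d =
        (λ p∈ q∉ → [ (λ (p≡a , _) → ⊥-elim (a∉ (subst (_∈ S) p≡a p∈))) , proj₁ ]′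
                     (crossing p q p∈Y q∈Y d (inj₁ (p∈ , q∉)))) ,
        (λ p∉ q∈' → [ proj₂ , (λ (_ , q≡a) → ⊥-elim (a∉ (subst (_∈ S) q≡a q∈'))) ]′
                      (crossing p q p∈Y q∈Y d (inj₂ (p∉ , q∈'))))

      shrink : StronglyConnected (DMinus M) Y → StronglyConnected (DMinus ((a , b) ∷ M)) S
      shrink Y-sc p q p∈ q∈ =
        mapʷ (λ _ m → m) inside-S
             (proj₁ (shortcut _ (_∈? S) (attached (a ∈? S)) (Y-sc p q (S⊆Y p∈) (S⊆Y q∈)) q∈) p∈)

    component-SC : ∀ M → (∀ {e} → e LM.∈ M → Bridge e) → ∀ x → x ∈ W →
      StronglyConnected (DMinus M) (component M x)
    component-SC [] _ x x∈ p q p∈ q∈ =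
      mapʷ (λ z z∈ → ∈component⁺ [] x (reach-none (connected x z x∈ z∈)))
           (λ _ _ _ _ d → d , λ { (inj₁ ()) ; (inj₂ ()) })
           (D-sc p q (component⊆W [] x p∈) (component⊆W [] x q∈))
    component-SC ((a , b) ∷ M) bridges x x∈ =
      Shrink.shrink a b M (bridges (here refl)) x (component-SC M (λ m → bridges (there m)) x x∈)

twin-free-edge : ∀ {n} (G F : Digraph n) → (∀ p q → Edge F p q → Edge G p q) →
  (∀ p q → ¬ (Edge F p q × Edge F q p)) → ∀ {p q} → Edge F p q → UAdj G p q
twin-free-edge G F F⊆G twin-free {p} {q} e = (λ { refl → twin-free p p (e , e) }) , inj₁ (F⊆G p q e)

-- The underlying graph of a twinless strongly connected digraph is
-- bridgeless: if F is the twin-free strongly connected spanning subgraph,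
-- an F-walk between x and y that stops at its first arrival uses neither
-- orientation of {x , y} (choosing the direction according to whether
-- (y , x) is an edge of F).
bridgeless : ∀ {n} (G : Digraph n) → TwinlessSC G ⊤ →
  ∀ x y → UAdj G x y → Walk ⊤ (WithoutEdge G (x , y)) x y
bridgeless G (F , F⊆G , twin-free , sc) x y _ with edge? F y x
... | no ¬y→x =
  reverseʷ (BridgeRemoval.without-sym (UAdj G) (uadj? G) (uadj-sym G) ⊤ (x , y))
    (mapʷ (λ _ m → m)
          (λ p q _ _ (e , p≢x) →
             twin-free-edge G F F⊆G twin-free e ,
             λ { (inj₁ (p≡x , _)) → p≢x p≡x
               ; (inj₂ (p≡y , q≡x)) → ¬y→x (subst₂ (Edge F) p≡y q≡x e) })
          (toFirstArrival (sc y x ∈⊤ ∈⊤)))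
... | yes y→x =
  mapʷ (λ _ m → m)
       (λ p q _ _ (e , p≢y) →
          twin-free-edge G F F⊆G twin-free e ,
          λ { (inj₁ (p≡x , q≡y)) → twin-free y x (y→x , subst₂ (Edge F) p≡x q≡y e)
            ; (inj₂ (p≡y , _)) → p≢y p≡y })
       (toFirstArrival (sc x y ∈⊤ ∈⊤))

module Deletion {n : ℕ} (G : Digraph n) (v : Fin n) (C : Subset n) (tsc : TwinlessSC G ⊤)
  (block : Block G C) (v∈C : v ∈ C) (W-sc : StronglyConnected (Edge G) (⊤ - v)) where

  W : Subset n
  W = ⊤ - v

  U : Rel {n}
  U = UAdj G

  open BridgeRemoval U (uadj? G) (uadj-sym G) W public

  ∈W : ∀ {z} → z ≢ v → z ∈ W
  ∈W z≢v = x∈p∧x≢y⇒x∈p-y ∈⊤ z≢v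

  ≢v : ∀ {z} → z ∈ W → z ≢ v
  ≢v z∈ = proj₂ (x∈p-y⇒x∈p×x≢y ⊤ z∈)

  C-v⊆W : ∀ {z} → z ∈ C - v → z ∈ W
  C-v⊆W z∈ = ∈W (proj₂ (x∈p-y⇒x∈p×x≢y C z∈))

  W-connected : Connected U W
  W-connected x y x∈ y∈ = undirected G (W-sc x y x∈ y∈)

  C-cut : ∀ x → x ∈ C → Connected U (C - x)
  C-cut = proj₂ (proj₂ (proj₁ block))

  c₀Σ : Σ (Fin n) λ c → c ∈ C × c ≢ v
  c₀Σ with proj₁ (proj₁ block)
  ... | a , b , a∈ , b∈ , a≢b with a ≟ v
  ...   | yes refl = b , b∈ , λ b≡a → a≢b (sym b≡a)
  ...   | no a≢v = a , a∈ , a≢v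

  c₀ : Fin n
  c₀ = proj₁ c₀Σ
  c₀∈C : c₀ ∈ C
  c₀∈C = proj₁ (proj₂ c₀Σ)
  c₀∈C-v : c₀ ∈ C - v
  c₀∈C-v = x∈p∧x≢y⇒x∈p-y c₀∈C (proj₂ (proj₂ c₀Σ))
  c₀∈W : c₀ ∈ W
  c₀∈W = C-v⊆W c₀∈C-v

  avoid-outside : ∀ {a b} → a ∉ C - v → ∀ {p q} → Walk (C - v) U p q → Walk (C - v) (Without (a , b)) p q
  avoid-outside a∉ = mapʷ (λ _ m → m) (λ p q p∈ q∈ u →
    u , λ { (inj₁ (p≡a , _)) → a∉ (subst (_∈ C - v) p≡a p∈) ; (inj₂ (_ , q≡a)) → a∉ (subst (_∈ C - v) q≡a q∈) })

  forget-removal : ∀ {S e p q} → Walk S (Without e) p q → Walk S U p q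
  forget-removal = mapʷ (λ _ m → m) (λ _ _ _ _ r → proj₁ r)

  through-C : ∀ {x y p q} → x ∉ C → Walk (C - v) U p q → Walk W (Without (x , y)) p q
  through-C x∉C = mapʷ (λ _ → C-v⊆W) (λ _ _ _ _ r → r) ∘ avoid-outside (λ m → x∉C (proj₁ (x∈p-y⇒x∈p×x≢y C m)))

  -- No walk in W leads from a neighbour p ∉ C of v into C: together with v
  -- it would form an ear of C.
  no-ear-at-v : ∀ {p c} → p ∈ W → p ∉ C → U v p → Walk W U p c → c ∈ C → ⊥
  no-ear-at-v p∈ p∉C v-p p⇝c c∈C with proj₂ (enter-block G C block (λ _ _ r → r) p⇝c c∈C) p∉C
  ... | c' , c'∈C , t , out , t-c' , c'⇝c =
    no-ear G C block v∈C c'∈C (λ v≡c' → ≢v (proj₁ (x∈p∩q⁻ W C (source c'⇝c))) (sym v≡c')) v-p out t-c'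

  exit-through-v : ∀ {x y s t} → s ∈ W → Walk ⊤ (Without (x , y)) s t → ¬ Walk W (Without (x , y)) s t →
    ∃[ p ] (Walk W (Without (x , y)) s p × U p v)
  exit-through-v {x} {y} {s} s∈ ω ¬s⇝t with firstExit (walk? (without? (x , y)) W s) ω (here s∈) ¬s⇝t
  ... | p , q , s⇝p , ¬s⇝q , p-q , _ , _ with q ≟ v
  ...   | yes refl = p , s⇝p , proj₁ p-q
  ...   | no q≢v = ⊥-elim (¬s⇝q (snocʷ s⇝p p-q (∈W q≢v)))

  -- G^u has a bypass ω; if it cannot be kept in W, it passes through v.
  -- Take the side (of x or of y) not reaching c₀ ∈ C - v without {x , y}:
  -- the walk leaves it at a neighbour p of v, and p ∉ C (C - v would lead
  -- on to c₀), but p reaches C in W, giving an ear of C at v.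
  bypass-off-block : ∀ {x y} → x ∈ W → y ∈ W → U x y → x ∉ C → Walk W (Without (x , y)) x y
  bypass-off-block {x} {y} x∈ y∈ x-y x∉C with walk? (without? (x , y)) W x y
  ... | yes x⇝y = x⇝y
  ... | no ¬x⇝y = ⊥-elim (no-bypass (walk? (without? (x , y)) W x c₀))
    where
    ω : Walk ⊤ (Without (x , y)) x y
    ω = bridgeless G tsc x y x-y
    no-bypass : Dec (Walk W (Without (x , y)) x c₀) → ⊥
    no-bypass (no ¬x⇝c₀) =
      let (p , x⇝p , p-v) = exit-through-v x∈ ω ¬x⇝y
          p∉C : p ∉ C
          p∉C p∈C = ¬x⇝c₀ (x⇝p ++ʷ through-C x∉C
                             (C-cut v v∈C p c₀ (x∈p∧x≢y⇒x∈p-y p∈C (≢v (target x⇝p))) c₀∈C-v))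
      in no-ear-at-v (target x⇝p) p∉C (uadj-sym G p v p-v)
           (forget-removal (reverseʷ (without-sym _) x⇝p) ++ʷ step x∈ x-y (W-connected y c₀ y∈ c₀∈W)) c₀∈C
    no-bypass (yes x⇝c₀) =
      let (p , y⇝p , p-v) = exit-through-v y∈ (reverseʷ (without-sym _) ω)
                                           (λ y⇝x → ¬x⇝y (reverseʷ (without-sym _) y⇝x))
          p∉C : p ∉ C
          p∉C p∈C = ¬x⇝y (x⇝c₀ ++ʷ through-C x∉C
                                    (C-cut v v∈C c₀ p c₀∈C-v (x∈p∧x≢y⇒x∈p-y p∈C (≢v (target y⇝p))))
                           ++ʷ reverseʷ (without-sym _) y⇝p)
      in no-ear-at-v (target y⇝p) p∉C (uadj-sym G p v p-v)
           (forget-removal (reverseʷ (without-sym _) y⇝p) ++ʷ step y∈ (uadj-sym G x y x-y) (forget-removal x⇝c₀))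
           c₀∈C

  connected-without? : ∀ e (S : Subset n) → Dec (Connected (Without e) S)
  connected-without? e S = all? (λ x → all? (λ y → (x ∈? S) →-dec ((y ∈? S) →-dec walk? (without? e) S x y)))

  countEdge? : Decidable (CountEdge G C v)
  countEdge? (a , b) =
    ((toℕ a ℕ.<? toℕ b) ×-dec uadj? G a b) ×-dec (a ∈? C) ×-dec (b ∈? C) ×-dec ¬? (connected-without? (a , b) (C - v))

  counted : List (Fin n × Fin n)
  counted = filter countEdge? (cartesianProduct (allFin n) (allFin n))

  counted-unique : Unique counted
  counted-unique = UniqueP.filter⁺ countEdge? (UniqueP.cartesianProduct⁺ (UniqueP.allFin⁺ n) (UniqueP.allFin⁺ n))

  ∈counted⁻ : ∀ {e} → e LM.∈ counted → CountEdge G C v e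
  ∈counted⁻ m = proj₂ (LMP.∈-filter⁻ countEdge? {xs = cartesianProduct (allFin n) (allFin n)} m)

  ∈counted⁺ : ∀ {e} → CountEdge G C v e → e LM.∈ counted
  ∈counted⁺ {a , b} counts = LMP.∈-filter⁺ countEdge? (LMP.∈-cartesianProduct⁺ (LMP.∈-allFin a) (LMP.∈-allFin b)) counts

  count-counted : Count (CountEdge G C v) (length counted)
  count-counted = counted , counted-unique , (λ e → mk⇔ ∈counted⁺ ∈counted⁻) , refl

  counted-oriented : ∀ {a b} → (a , b) LM.∈ counted → toℕ a ℕ.< toℕ b
  counted-oriented m = proj₁ (proj₁ (∈counted⁻ m))

  -- Counted edges are bridges of G^u[W]: their ends differ from v (C - v
  -- is connected), and a bypass in W could be kept inside C - v (no ears),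
  -- where it would reconnect C \ {v , e}.
  counted-bridge : ∀ {e} → e LM.∈ counted → Bridge e
  counted-bridge {a , b} m with ∈counted⁻ m
  ... | (_ , a-b) , a∈C , b∈C , disconnected = ∈W a≢v , ∈W b≢v , a-b , ¬bypass
    where
    v∉C-v : v ∉ C - v
    v∉C-v m = proj₂ (x∈p-y⇒x∈p×x≢y C m) refl
    a≢v : a ≢ v
    a≢v refl = disconnected (λ p q p∈ q∈ → avoid-outside v∉C-v (C-cut v v∈C p q p∈ q∈))
    b≢v : b ≢ v
    b≢v refl = disconnected (λ p q p∈ q∈ →
      mapʷ (λ _ m → m) (λ p q _ _ → without-flip p q) (avoid-outside v∉C-v (C-cut v v∈C p q p∈ q∈)))
    ¬bypass : ¬ Walk W (Without (a , b)) a b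
    ¬bypass a⇝b = disconnected (λ p q p∈ q∈ → substituteʷ (bypass-every-edge in-C-v) (λ _ m → m) (C-cut v v∈C p q p∈ q∈))
      where
      in-C-v : Walk (C - v) (Without (a , b)) a b
      in-C-v = mapʷ (λ z m → let (z∈W , z∈C) = x∈p∩q⁻ W C m in x∈p∧x≢y⇒x∈p-y z∈C (≢v z∈W)) (λ _ _ _ _ r → r)
                    (stay-in-block G C block (λ _ _ r → proj₁ r) a⇝b a∈C b∈C)

  -- Uncounted edges of G^u[W] are not bridges of G^u[W]: off the block
  -- this is bypass-off-block; inside the block, C \ {v , e} is connected.
  uncounted-bypass : ∀ x y → x ∈ W → y ∈ W → U x y → ¬ Listed counted x y → Walk W (Without (x , y)) x y
  uncounted-bypass x y x∈ y∈ x-y ¬listed with x ∈? C | y ∈? C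
  ... | no x∉C | _ = bypass-off-block x∈ y∈ x-y x∉C
  ... | yes _ | no y∉C =
    mapʷ (λ _ m → m) (λ p q _ _ → without-flip p q)
         (reverseʷ (without-sym _) (bypass-off-block y∈ x∈ (uadj-sym G x y x-y) y∉C))
  ... | yes x∈C | yes y∈C with ℕP.<-cmp (toℕ x) (toℕ y)
  ...   | tri≈ _ x≡y _ = ⊥-elim (proj₁ x-y (toℕ-injective x≡y))
  ...   | tri< x<y _ _ =
    mapʷ (λ _ → C-v⊆W) (λ _ _ _ _ r → r)
         (decidable-stable (connected-without? (x , y) (C - v))
                           (λ ¬c → ¬listed (inj₁ (∈counted⁺ ((x<y , x-y) , x∈C , y∈C , ¬c))))
                           x y (x∈p∧x≢y⇒x∈p-y x∈C (≢v x∈)) (x∈p∧x≢y⇒x∈p-y y∈C (≢v y∈)))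
  ...   | tri> _ _ y<x =
    mapʷ (λ _ → C-v⊆W) (λ p q _ _ → without-flip p q)
         (decidable-stable (connected-without? (y , x) (C - v))
                           (λ ¬c → ¬listed (inj₂ (∈counted⁺ ((y<x , uadj-sym G x y x-y) , y∈C , x∈C , ¬c))))
                           x y (x∈p∧x≢y⇒x∈p-y x∈C (≢v x∈)) (x∈p∧x≢y⇒x∈p-y y∈C (≢v y∈)))

  open IteratedTwinRemoval G W (Listed counted) (listed? counted) uncounted-bypass
    using (Invariant; twin-free-up-to-allowed)

  pruned : Σ (Digraph n) λ D → Invariant D ×
    (∀ x y → x ≢ y → x ∈ W → y ∈ W → Edge D x y → Edge D y x → Listed counted x y)
  pruned = twin-free-up-to-allowed W-sc

  D : Digraph n
  D = proj₁ pruned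

  D⊆G : ∀ p q → Edge D p q → Edge G p q
  D⊆G = proj₁ (proj₁ (proj₂ pruned))

  D-sc : StronglyConnected (Edge D) W
  D-sc = proj₁ (proj₂ (proj₁ (proj₂ pruned)))

  D-twins-counted : ∀ x y → x ≢ y → x ∈ W → y ∈ W → Edge D x y → Edge D y x → Listed counted x y
  D-twins-counted = proj₂ (proj₂ pruned)

  F? : Dec₂ (λ p q → Edge D p q × ¬ Listed counted p q × p ∈ W × q ∈ W × p ≢ q)
  F? p q = edge? D p q ×-dec ¬? (listed? counted p q) ×-dec (p ∈? W) ×-dec (q ∈? W) ×-dec ¬? (p ≟ q)

  F : Digraph n
  F p q = does (F? p q)

  component-twinless : ∀ x → x ∈ W → TwinlessSC G (component counted x)
  component-twinless x x∈ =
    F , (λ p q e → D⊆G p q (proj₁ (from-does (F? p q) e))) , twin-free , F-sc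
    where
    twin-free : ∀ p q → ¬ (Edge F p q × Edge F q p)
    twin-free p q (p→q , q→p) =
      let (d₁ , ¬listed , p∈ , q∈ , p≢q) = from-does (F? p q) p→q
          (d₂ , _) = from-does (F? q p) q→p
      in ¬listed (D-twins-counted p q p≢q p∈ q∈ d₁ d₂)
    F-sc : StronglyConnected (Edge F) (component counted x)
    F-sc p q p∈ q∈ =
      mapʷ (λ _ m → m)
           (λ a b a∈ b∈ ((e , ¬listed) , a≢b) →
             dec-true (F? a b) (e , ¬listed , component⊆W counted x a∈ , component⊆W counted x b∈ , a≢b))
           (dropLoops (component-SC W-connected (Edge D) (λ p q p≢q e → p≢q , inj₁ (D⊆G p q e)) D-sc
                                    counted counted-bridge x x∈ p q p∈ q∈))

  twinless-within-component : ∀ T → TwinlessSC G T → (∀ z → z ∈ T → z ∈ W) →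
    ∀ {x y} → x ∈ T → y ∈ T → Reach counted x y
  twinless-within-component T (F' , F'⊆G , twin-free , sc) T⊆W =
    within-component (Edge F') (λ p q p≢q e → p≢q , inj₁ (F'⊆G p q e)) twin-free T⊆W sc counted counted-bridge

  count-TSCCs : Count (TSCC G W) (suc (length counted))
  count-TSCCs =
    count-components counted (TSCC G W) TSCC-component component-TSCC
      (count-representatives W-connected c₀∈W counted counted-unique counted-bridge counted-oriented)
    where
    TSCC-component : ∀ S → TSCC G W S → ∃[ x ] (x ∈ W × S ≡ component counted x)
    TSCC-component S (S⊆W , (x , x∈S) , twinless , maximal) =
      x , x∈W , subset-ext (λ z z∈ → S⊆component z∈)
                           (λ z z∈ → maximal (component counted x) S⊆component (component⊆W counted x)
                                             (component-twinless x x∈W) z∈)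
      where
      x∈W : x ∈ W
      x∈W = S⊆W x∈S
      S⊆component : S ⊆ component counted x
      S⊆component z∈ = ∈component⁺ counted x (twinless-within-component S twinless (λ _ m → S⊆W m) x∈S z∈)
    component-TSCC : ∀ x → x ∈ W → TSCC G W (component counted x)
    component-TSCC x x∈ =
      (component⊆W counted x) , (x , ∈component⁺ counted x (here x∈)) , component-twinless x x∈ ,
      λ T S⊆T T⊆W twinless z∈ →
        ∈component⁺ counted x (twinless-within-component T twinless (λ _ m → T⊆W m)
                                 (S⊆T (∈component⁺ counted x (here x∈))) z∈)

-- The theorem.
lemma6 : {n : ℕ} (G : Digraph n) (v : Fin n) (C : Subset n) →
    TwinlessSC G ⊤ →
    TwinlessStrongArticulationPoint G v →
    ¬ StrongArticulationPoint G v →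
    Block G C → v ∈ C →
    ∃[ k ] (Count (CountEdge G C v) k × NumTSCC G (⊤ - v) (suc k))
lemma6 G v C twinless _ ¬SAP block v∈C = length counted , count-counted , count-TSCCs
  where
  open Deletion G v C twinless block v∈C (SC-minus-non-SAP G v (twinless⇒strong G twinless) ¬SAP)
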